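{- Let $A$ be a finite alphabet of colors and $J$ a sentence over $A$. Then $$\mathfrak{S}^*_J=\sum_{C}L_{J,C}\,F_C,$$ where the sum runs over sentences $C$ with $|C|=|J|$ and $L_{J,C}$ is the number of standard colored immaculate tableaux of shape $J$ with colored descent composition $C$; in particular $\mathfrak{S}^*_J$ is a nonnegative combination of colored fundamental functions.
   Context: Words over $A$ are finite sequences of colors; a sentence is a finite sequence $I=(w_1,\dots,w_k)$ of nonempty words; $|I|$ is its number of letters and $w(I)=w_1\cdots w_k$. $J\preceq I$ means $w(J)=w(I)$ and $I$ arises from $J$ by concatenating some adjacent words. Let $x_{a,i}$ ($a\in A$, $i\in\mathbb{Z}_{>0}$) be variables subject only to $x_{a,i}x_{b,j}=x_{b,j}x_{a,i}$ for $i\ne j$; for a word $w=c_1\cdots c_r$, $x_{w,i}=x_{c_1,i}\cdots x_{c_r,i}$, $x_{\emptyset,i}=1$. $M_I=\sum_{j_1<\dots<j_k}x_{w_1,j_1}\cdots x_{w_k,j_k}$ and the colored fundamental function is $F_I=\sum_{J\preceq I}M_J$. For $J=(w_1,\dots,w_k)$ the colored composition diagram of shape $J$ has $k$ left-justified rows (row 1 on top), row $i$ having $|w_i|$ boxes colored in order by the letters of $w_i$. A colored immaculate tableau (CIT) of shape $J$ fills its boxes with positive integers, weakly increasing left to right in rows and strictly increasing top to bottom in the first column; its type is $(u_1,\dots,u_m)$ with $u_i$ the word of colors of the boxes containing $i$ read from the lowest row to the highest row and left to right within rows; $x_T=x_{u_1,1}\cdots x_{u_m,m}$ and $\mathfrak{S}^*_J=\sum_T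 x_T$ over all CIT of shape $J$. A standard CIT of size $n$ has entries $1,\dots,n$ each once; it has a descent at $i$ if $i+1$ is in a strictly lower row than $i$; its colored descent composition $co_A(U)$ is the sentence obtained by reading the box colors in order of entries $1,\dots,n$ and starting a new word after each descent. -}

module Defs where

open import Data.Nat using (ℕ; zero; suc; _+_; _*_; pred; _<ᵇ_)
open import Data.Bool using (Bool; true; false; if_then_else_)
open import Data.Fin using (Fin) renaming (_≤?_ to _≤ᶠ?_; _<?_ to _<ᶠ?_; _≟_ to _≟ᶠ_)
open import Data.Fin.Subset using (Subset)
open import Data.Fin.Subset.Properties using (anySubset?)
open import Data.List using (List; []; _∷_; _++_; length; map; concat; concatMap; filter; zip; reverse; allFin; mapMaybe; take)
open import Data.Nat.ListAction using (sum)
import Data.List.Properties as ListP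
open import Data.List.Relation.Unary.Linked using (Linked; linked?)
open import Data.List.Relation.Unary.All using (All; all?)
open import Data.Vec using (Vec; tabulate; zipWith; replicate)
import Data.Vec as V
import Data.Vec.Properties as VecP
open import Data.Product using (Σ; _×_; _,_; proj₁; proj₂)
open import Data.Maybe using (Maybe; just; nothing)
open import Relation.Nullary using (Dec; does; yes; no; ¬_)
open import Relation.Nullary.Decidable using (_×-dec_)
open import Relation.Unary using (Decidable; Pred)
open import Relation.Binary.PropositionalEquality using (_≡_; _≢_)

count : ∀ {a p} {X : Set a} {P : Pred X p} → Decidable P → List X → ℕ
count P? xs = length (filter P? xs)

Word : ℕ → Set
Word k = List (Fin k)

Sentence : ℕ → Set
Sentence k = List (Word k)

IsSentence : ∀ {k} → Sentence k → Set
IsSentence I = All (λ w → w ≢ []) I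

size : ∀ {k} → Sentence k → ℕ
size I = sum (map length I)

-- all sentences (nonempty words) with exactly n letters, each listed once:
-- the first letter either forms its own word or is prepended to the first word
extendBy : ∀ {k} → Fin k → Sentence k → List (Sentence k)
extendBy c []       = ((c ∷ []) ∷ []) ∷ []
extendBy c (w ∷ ws) = ((c ∷ []) ∷ w ∷ ws) ∷ ((c ∷ w) ∷ ws) ∷ []

sentencesOfSize : (k n : ℕ) → List (Sentence k)
sentencesOfSize k zero    = [] ∷ []
sentencesOfSize k (suc n) =
  concatMap (λ s → concatMap (λ c → extendBy c s) (allFin k)) (sentencesOfSize k n)

-- A subset S of the (length J - 1) gaps between consecutive words of J is
-- chosen; the words on both sides of each chosen gap are concatenated.

prependHead : ∀ {k} → Word k → Sentence k → Sentence k
prependHead w []       = w ∷ []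
prependHead w (v ∷ vs) = (w ++ v) ∷ vs

mergeAt : ∀ {k} (J : Sentence k) → Subset (pred (length J)) → Sentence k
mergeAt []             _       = []
mergeAt (w ∷ [])       _       = w ∷ []
mergeAt (w ∷ v ∷ J)    (b V.∷ S) =
  if b then prependHead w (mergeAt (v ∷ J) S) else w ∷ mergeAt (v ∷ J) S

_⪯_ : ∀ {k} → Sentence k → Sentence k → Set
J ⪯ I = Σ (Subset (pred (length J))) (λ S → mergeAt J S ≡ I)

sent-≟ : ∀ {k} (I J : Sentence k) → Dec (I ≡ J)
sent-≟ = ListP.≡-dec (ListP.≡-dec _≟ᶠ_)

_⪯?_ : ∀ {k} (J I : Sentence k) → Dec (J ⪯ I)
J ⪯? I = anySubset? (λ S → sent-≟ (mergeAt J S) I)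

-- The variables x_{a,i} with x_{a,i}x_{b,j}=x_{b,j}x_{a,i} for
-- i ≠ j generate the direct product over i of free monoids on A; a
-- monomial involving only indices 1..m is a vector (u_1,…,u_m) of words
-- (index i+1 ↦ position i : Fin m), with pointwise concatenation as product.

Mono : ℕ → ℕ → Set
Mono k m = Vec (Word k) m

mono-≟ : ∀ {k m} (u v : Mono k m) → Dec (u ≡ v)
mono-≟ = VecP.≡-dec (ListP.≡-dec _≟ᶠ_)

oneM : ∀ {k m} → Mono k m
oneM = replicate _ []

_·_ : ∀ {k m} → Mono k m → Mono k m → Mono k m
u · v = zipWith _++_ u v

xw : ∀ {k m} → Word k → Fin m → Mono k m
xw w i = tabulate (λ i′ → if does (i′ ≟ᶠ i) then w else [])

allLists : (m l : ℕ) → List (List (Fin m))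
allLists m zero    = [] ∷ []
allLists m (suc l) = concatMap (λ i → map (i ∷_) (allLists m l)) (allFin m)

-- Coefficients of M_I and F_I at a monomial u supported on indices 1..m.
-- (A term x_{w_1,j_1}⋯x_{w_k,j_k} with some j_l > m has a nonempty word at
-- index j_l, so it never equals u; hence only j's in 1..m contribute.)

termM : ∀ {k m} → Sentence k → List (Fin m) → Mono k m
termM I js = Data.List.foldr (λ p acc → xw (proj₁ p) (proj₂ p) · acc) oneM (zip I js)

coeffM : ∀ {k m} → Sentence k → Mono k m → ℕ
coeffM {m = m} I u =
  count (λ js → mono-≟ (termM I js) u)
        (filter (linked? _<ᶠ?_) (allLists m (length I)))

-- F_I = Σ_{J ⪯ I} M_J (every such J is a sentence with |J| = |I|)
coeffF : ∀ {k m} → Sentence k → Mono k m → ℕ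
coeffF {k} I u =
  sum (map (λ J → coeffM J u) (filter (λ J → J ⪯? I) (sentencesOfSize k (size I))))

-- Fillings of the colored composition diagram of shape J.  A filling is the
-- list of rows (top row first) of entries; entries in Fin m stand for 1..m.

fillings : ∀ {k} (m : ℕ) → Sentence k → List (List (List (Fin m)))
fillings m []       = [] ∷ []
fillings m (w ∷ J)  = concatMap (λ r → map (r ∷_) (fillings m J)) (allLists m (length w))

firstColumn : ∀ {m} → List (List (Fin m)) → List (Fin m)
firstColumn T = concatMap (take 1) T

IsCIT : ∀ {m} → List (List (Fin m)) → Set
IsCIT T = All (Linked Data.Fin._≤_) T × Linked Data.Fin._<_ (firstColumn T)

isCIT? : ∀ {m} (T : List (List (Fin m))) → Dec (IsCIT T)
isCIT? T = all? (linked? _≤ᶠ?_) T ×-dec linked? _<ᶠ?_ (firstColumn T)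

rowColorsOf : ∀ {k m} → Fin m → Word k × List (Fin m) → Word k
rowColorsOf i (w , r) = map proj₁ (filter (λ p → proj₂ p ≟ᶠ i) (zip w r))

-- x_T: at index i the colors of the boxes containing i, read from the
-- lowest row to the highest, left to right within rows
monoT : ∀ {k m} → Sentence k → List (List (Fin m)) → Mono k m
monoT J T = tabulate (λ i → concat (map (rowColorsOf i) (reverse (zip J T))))

coeffS : ∀ {k m} → Sentence k → Mono k m → ℕ
coeffS {m = m} J u =
  count (λ T → isCIT? T ×-dec mono-≟ (monoT J T) u) (fillings m J)

IsStandard : ∀ {n} → List (List (Fin n)) → Set
IsStandard {n} T = IsCIT T × All (λ i → count (λ e → e ≟ᶠ i) (concat T) ≡ 1) (allFin n)

isStandard? : ∀ {n} (T : List (List (Fin n))) → Dec (IsStandard T)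
isStandard? {n} T =
  isCIT? T ×-dec all? (λ i → count (λ e → e ≟ᶠ i) (concat T) Data.Nat.≟ 1) (allFin n)

-- boxes as (row index (top row = 0), color, entry)
boxesRow : ∀ {k n} → ℕ → Sentence k → List (List (Fin n)) → List (ℕ × Fin k × Fin n)
boxesRow r (w ∷ J) (t ∷ T) = map (λ p → r , p) (zip w t) ++ boxesRow (suc r) J T
boxesRow r _       _       = []

locate : ∀ {k n} → List (ℕ × Fin k × Fin n) → Fin n → Maybe (ℕ × Fin k)
locate []                  i = nothing
locate ((r , c , e) ∷ bs)  i = if does (e ≟ᶠ i) then just (r , c) else locate bs i

consHead : ∀ {k} → Fin k → Sentence k → Sentence k
consHead c []       = (c ∷ []) ∷ []
consHead c (w ∷ ws) = (c ∷ w) ∷ ws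

-- from the (row, color) of entries 1..n in order: a new word starts after
-- i exactly when i+1 lies in a strictly lower row (larger row index)
coFrom : ∀ {k} → List (ℕ × Fin k) → Sentence k
coFrom []                        = []
coFrom ((r , c) ∷ [])            = (c ∷ []) ∷ []
coFrom ((r , c) ∷ (r′ , c′) ∷ xs) =
  if r <ᵇ r′ then (c ∷ []) ∷ coFrom ((r′ , c′) ∷ xs)
            else consHead c (coFrom ((r′ , c′) ∷ xs))

coA : ∀ {k n} → Sentence k → List (List (Fin n)) → Sentence k
coA {n = n} J U = coFrom (mapMaybe (locate (boxesRow 0 J U)) (allFin n))

L : ∀ {k} → Sentence k → Sentence k → ℕ
L J C = count (λ U → isStandard? U ×-dec sent-≟ (coA J U) C) (fillings (size J) J)

module Submission where

-- The coefficient of a monomial u in F_C is 1 or 0 according as the nonempty words of u,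
-- read as a sentence, refine C; comparing letters and word starts one at a time makes this
-- a pointwise condition.  Hence both sides count fillings of the diagram of J: colored
-- immaculate tableaux of weight u on the left, standard ones whose colored descent
-- composition is refined by u on the right.  Both counts obey the same recursion in the
-- number of boxes.  Write u = u⁻ · x_{c,i} with i the largest index carrying a letter.  In a
-- tableau of weight u that letter is read from the last box of the topmost row r containing
-- i; in a standard tableau the largest entry plays this role.  In both cases the box must
-- end a row whose removal leaves all rows nonempty and the first column strictly
-- increasing, that row must end in color c, and what remains is counted by the same quantity
-- for u⁻, with the further copies of i, resp. the new largest entry, confined to rows ≥ r
-- exactly when u_i has letters before c.  Equal recursions and equal base cases give the
-- theorem.

open import Defs
open import Data.Nat using (ℕ; zero; suc; _+_; _*_; pred; _≤_; _<_; z≤n; s≤s; _≤?_; _<ᵇ_)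
import Data.Nat.Properties as ℕ
open import Data.Bool using (Bool; true; false; T; not)
open import Data.Bool.Properties using () renaming (_≟_ to _≟ᵇ_)
open import Data.Fin using (Fin; toℕ; fromℕ<) renaming (zero to fzero; suc to fsuc; _≟_ to _≟ᶠ_)
import Data.Fin as F
import Data.Fin.Properties as FinP
open import Data.List
  using (List; []; _∷_; _++_; _∷ʳ_; length; map; concat; concatMap; filter; zip; reverse; take; drop;
         upTo; applyUpTo; allFin; mapMaybe; last; null)
import Data.List.Properties as ListP
open import Data.List.Relation.Unary.All using (All; []; _∷_; all?)
import Data.List.Relation.Unary.All as All
import Data.List.Relation.Unary.All.Properties as AllP
open import Data.List.Relation.Unary.Any using (Any; here; there; any?; satisfied)
import Data.List.Relation.Unary.Any as Any
import Data.List.Relation.Unary.Any.Properties as AnyP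
open import Data.List.Relation.Unary.Linked using (Linked; []; [-]; _∷_; linked?)
open import Data.List.Relation.Binary.Pointwise as Pointwise using (Pointwise; []; _∷_)
import Data.List.Membership.Propositional.Properties as ∈P
open import Data.Maybe using (Maybe; just; nothing)
import Data.Maybe.Properties as MaybeP
open import Data.Vec using (Vec; _∷_; []; lookup; tabulate)
import Data.Vec.Properties as VecP
open import Data.Nat.ListAction using (sum)
open import Data.Product using (Σ; _×_; _,_; proj₁; proj₂)
open import Data.Sum using (_⊎_; inj₁; inj₂)
open import Data.Empty using (⊥; ⊥-elim)
open import Relation.Nullary using (Dec; yes; no; ¬_)
open import Relation.Nullary.Decidable using (_×-dec_; _→-dec_; ¬?)
open import Relation.Unary using (Decidable; Pred)
open import Relation.Binary using (tri<; tri≈; tri>)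
open import Relation.Binary.PropositionalEquality
open import Function using (case_of_; _⇔_; mk⇔; Equivalence)

𝟙 : ∀ {p} {P : Set p} → Dec P → ℕ
𝟙 (yes _) = 1
𝟙 (no _)  = 0

∑ : ∀ {a} {A : Set a} → List A → (A → ℕ) → ℕ
∑ xs f = sum (map f xs)

module _ {p q} {P : Set p} {Q : Set q} where

  𝟙-cong : (P? : Dec P) (Q? : Dec Q) → (P → Q) → (Q → P) → 𝟙 P? ≡ 𝟙 Q?
  𝟙-cong (yes _) (yes _) _ _ = refl
  𝟙-cong (yes p) (no ¬q) f _ = ⊥-elim (¬q (f p))
  𝟙-cong (no ¬p) (yes q) _ g = ⊥-elim (¬p (g q))
  𝟙-cong (no _)  (no _)  _ _ = refl

  𝟙-× : (P? : Dec P) (Q? : Dec Q) → 𝟙 (P? ×-dec Q?) ≡ 𝟙 P? * 𝟙 Q?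
  𝟙-× (yes _) (yes _) = refl
  𝟙-× (yes _) (no _)  = refl
  𝟙-× (no _)  _       = refl

module _ {p} {P : Set p} where

  𝟙-yes : (P? : Dec P) → P → 𝟙 P? ≡ 1
  𝟙-yes (yes _) _  = refl
  𝟙-yes (no ¬p) p = ⊥-elim (¬p p)

  𝟙-no : (P? : Dec P) → ¬ P → 𝟙 P? ≡ 0
  𝟙-no (yes p) ¬p = ⊥-elim (¬p p)
  𝟙-no (no _)  _  = refl

module _ {a} {A : Set a} where

  ∑-++ : ∀ (xs ys : List A) f → ∑ (xs ++ ys) f ≡ ∑ xs f + ∑ ys f
  ∑-++ []       ys f = refl
  ∑-++ (x ∷ xs) ys f = trans (cong (f x +_) (∑-++ xs ys f)) (sym (ℕ.+-assoc (f x) _ _))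

  ∑-cong : ∀ (xs : List A) {f g} → (∀ x → f x ≡ g x) → ∑ xs f ≡ ∑ xs g
  ∑-cong []       e = refl
  ∑-cong (x ∷ xs) e = cong₂ _+_ (e x) (∑-cong xs e)

  ∑-congᴬ : ∀ {p} {P : Pred A p} (xs : List A) {f g} → All P xs → (∀ x → P x → f x ≡ g x) →
            ∑ xs f ≡ ∑ xs g
  ∑-congᴬ []       _          e = refl
  ∑-congᴬ (x ∷ xs) (px ∷ pxs) e = cong₂ _+_ (e x px) (∑-congᴬ xs pxs e)

  ∑-zero : ∀ (xs : List A) → ∑ xs (λ _ → 0) ≡ 0
  ∑-zero []       = refl
  ∑-zero (x ∷ xs) = ∑-zero xs

  ∑-+ : ∀ (xs : List A) f g → ∑ xs (λ x → f x + g x) ≡ ∑ xs f + ∑ xs g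
  ∑-+ []       f g = refl
  ∑-+ (x ∷ xs) f g = begin
    f x + g x + ∑ xs (λ y → f y + g y)  ≡⟨ cong (f x + g x +_) (∑-+ xs f g) ⟩
    f x + g x + (∑ xs f + ∑ xs g)       ≡⟨ ℕ.+-assoc (f x) (g x) _ ⟩
    f x + (g x + (∑ xs f + ∑ xs g))     ≡⟨ cong (f x +_) (ℕ.+-comm (g x) _) ⟩
    f x + ((∑ xs f + ∑ xs g) + g x)     ≡⟨ cong (f x +_) (ℕ.+-assoc (∑ xs f) _ (g x)) ⟩
    f x + (∑ xs f + (∑ xs g + g x))     ≡⟨ sym (ℕ.+-assoc (f x) _ _) ⟩
    f x + ∑ xs f + (∑ xs g + g x)       ≡⟨ cong (f x + ∑ xs f +_) (ℕ.+-comm (∑ xs g) (g x)) ⟩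
    f x + ∑ xs f + (g x + ∑ xs g)       ∎
    where open ≡-Reasoning

  ∑-*ˡ : ∀ (xs : List A) c f → ∑ xs (λ x → c * f x) ≡ c * ∑ xs f
  ∑-*ˡ []       c f = sym (ℕ.*-zeroʳ c)
  ∑-*ˡ (x ∷ xs) c f = trans (cong (c * f x +_) (∑-*ˡ xs c f)) (sym (ℕ.*-distribˡ-+ c (f x) _))

  ∑-*ʳ : ∀ (xs : List A) c f → ∑ xs (λ x → f x * c) ≡ ∑ xs f * c
  ∑-*ʳ xs c f = trans (∑-cong xs (λ x → ℕ.*-comm (f x) c)) (trans (∑-*ˡ xs c f) (ℕ.*-comm c _))

  count≡∑𝟙 : ∀ {p} {P : Pred A p} (P? : Decidable P) xs → count P? xs ≡ ∑ xs (λ x → 𝟙 (P? x))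
  count≡∑𝟙 P? []       = refl
  count≡∑𝟙 P? (x ∷ xs) with P? x
  ... | yes _ = cong suc (count≡∑𝟙 P? xs)
  ... | no _  = count≡∑𝟙 P? xs

  count-cong : ∀ {p q} {P : Pred A p} {Q : Pred A q} (P? : Decidable P) (Q? : Decidable Q) xs →
               (∀ x → P x → Q x) → (∀ x → Q x → P x) → count P? xs ≡ count Q? xs
  count-cong P? Q? xs f g = begin
    count P? xs               ≡⟨ count≡∑𝟙 P? xs ⟩
    ∑ xs (λ x → 𝟙 (P? x))     ≡⟨ ∑-cong xs (λ x → 𝟙-cong (P? x) (Q? x) (f x) (g x)) ⟩
    ∑ xs (λ x → 𝟙 (Q? x))     ≡⟨ count≡∑𝟙 Q? xs ⟨
    count Q? xs               ∎
    where open ≡-Reasoning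

  ∑-filter : ∀ {p} {P : Pred A p} (P? : Decidable P) (xs : List A) f →
             ∑ (filter P? xs) f ≡ ∑ xs (λ x → 𝟙 (P? x) * f x)
  ∑-filter P? []       f = refl
  ∑-filter P? (x ∷ xs) f with P? x
  ... | yes _ = cong₂ _+_ (sym (ℕ.+-identityʳ (f x))) (∑-filter P? xs f)
  ... | no _  = ∑-filter P? xs f

  ∑-𝟙≡ : (_≟_ : (x y : A) → Dec (x ≡ y)) (xs : List A) (a₀ : A) (g : A → ℕ) →
         ∑ xs (λ x → 𝟙 (x ≟ a₀) * g x) ≡ count (λ x → x ≟ a₀) xs * g a₀
  ∑-𝟙≡ _≟_ []       a₀ g = refl
  ∑-𝟙≡ _≟_ (x ∷ xs) a₀ g with x ≟ a₀
  ... | yes refl = cong₂ _+_ (ℕ.+-identityʳ (g x)) (∑-𝟙≡ _≟_ xs a₀ g)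
  ... | no _     = ∑-𝟙≡ _≟_ xs a₀ g

  count≡0 : ∀ {p} {P : Pred A p} (P? : Decidable P) (xs : List A) → ¬ Any P xs → count P? xs ≡ 0
  count≡0 P? []       _  = refl
  count≡0 P? (x ∷ xs) na with P? x
  ... | yes p = ⊥-elim (na (here p))
  ... | no _  = count≡0 P? xs (λ a → na (there a))

  count≡0⇒¬Any : ∀ {p} {P : Pred A p} (P? : Decidable P) (xs : List A) → count P? xs ≡ 0 → ¬ Any P xs
  count≡0⇒¬Any P? (x ∷ xs) e a with P? x | a
  ... | yes _ | _        = ℕ.0≢1+n (sym e)
  ... | no ¬p | here p   = ¬p p
  ... | no _  | there a′ = count≡0⇒¬Any P? xs e a′

  count≡1⇒Any : ∀ {p} {P : Pred A p} (P? : Decidable P) (xs : List A) → count P? xs ≡ 1 → Any P xs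
  count≡1⇒Any P? xs e with any? P? xs
  ... | yes a  = a
  ... | no ¬a = ⊥-elim (ℕ.0≢1+n (trans (sym (count≡0 P? xs ¬a)) e))

module _ {a b} {A : Set a} {B : Set b} where

  ∑-map : ∀ (g : A → B) (xs : List A) f → ∑ (map g xs) f ≡ ∑ xs (λ x → f (g x))
  ∑-map g []       f = refl
  ∑-map g (x ∷ xs) f = cong (f (g x) +_) (∑-map g xs f)

  ∑-concatMap : ∀ (g : A → List B) (xs : List A) f → ∑ (concatMap g xs) f ≡ ∑ xs (λ x → ∑ (g x) f)
  ∑-concatMap g []       f = refl
  ∑-concatMap g (x ∷ xs) f =
    trans (∑-++ (g x) (concatMap g xs) f) (cong (∑ (g x) f +_) (∑-concatMap g xs f))

  ∑-swap : ∀ (xs : List A) (ys : List B) (f : A → B → ℕ) →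
           ∑ xs (λ x → ∑ ys (f x)) ≡ ∑ ys (λ y → ∑ xs (λ x → f x y))
  ∑-swap []       ys f = sym (∑-zero ys)
  ∑-swap (x ∷ xs) ys f =
    trans (cong (∑ ys (f x) +_) (∑-swap xs ys f)) (sym (∑-+ ys (f x) (λ y → ∑ xs (λ x′ → f x′ y))))

  count-map : ∀ {p} {P : Pred B p} (P? : Decidable P) (f : A → B) xs →
              count P? (map f xs) ≡ count (λ x → P? (f x)) xs
  count-map P? f xs =
    trans (count≡∑𝟙 P? (map f xs)) (trans (∑-map f xs _) (sym (count≡∑𝟙 (λ x → P? (f x)) xs)))

allFin-suc : ∀ n → allFin (suc n) ≡ fzero ∷ map fsuc (allFin n)
allFin-suc n = cong (fzero ∷_) (sym (ListP.map-tabulate (λ i → i) fsuc))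

count-allFin : ∀ n (i : Fin n) → count (_≟ᶠ i) (allFin n) ≡ 1
count-allFin (suc n) i = trans (cong (count (_≟ᶠ i)) (allFin-suc n)) (atIndex i)
  where
  atIndex : (i : Fin (suc n)) → count (_≟ᶠ i) (fzero ∷ map fsuc (allFin n)) ≡ 1
  atIndex fzero    = cong suc (trans (count-map (_≟ᶠ fzero) fsuc (allFin n))
                                (count≡0 _ (allFin n) (λ a → fsuc≢0 (satisfied a))))
    where fsuc≢0 : Σ (Fin n) (λ x → fsuc x ≡ fzero) → ⊥
          fsuc≢0 (_ , ())
  atIndex (fsuc j) = trans (count-map (_≟ᶠ fsuc j) fsuc (allFin n))
                      (trans (count-cong _ (_≟ᶠ j) (allFin n) (λ _ → FinP.suc-injective) (λ _ → cong fsuc))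
                             (count-allFin n j))

∑-allFin-𝟙≡ : ∀ n (i : Fin n) (g : Fin n → ℕ) → ∑ (allFin n) (λ x → 𝟙 (x ≟ᶠ i) * g x) ≡ g i
∑-allFin-𝟙≡ n i g = trans (∑-𝟙≡ _≟ᶠ_ (allFin n) i g)
                          (trans (cong (_* g i) (count-allFin n i)) (ℕ.+-identityʳ (g i)))

-- Refinement of sentences, read letter by letter

-- a letter together with the information whether it begins a word
Flag : ℕ → Set
Flag k = Fin k × Bool

module _ {k : ℕ} where

  wordFlags : Bool → Word k → List (Flag k)
  wordFlags b []      = []
  wordFlags b (c ∷ w) = (c , b) ∷ wordFlags false w

  flags : Sentence k → List (Flag k)
  flags []      = []
  flags (w ∷ J) = wordFlags true w ++ flags J

  _≼_ : Flag k → Flag k → Set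
  p ≼ q = proj₁ p ≡ proj₁ q × (proj₂ q ≡ true → proj₂ p ≡ true)

  _≼?_ : (p q : Flag k) → Dec (p ≼ q)
  p ≼? q = (proj₁ p ≟ᶠ proj₁ q) ×-dec ((proj₂ q ≟ᵇ true) →-dec (proj₂ p ≟ᵇ true))

  Refines : List (Flag k) → List (Flag k) → Set
  Refines = Pointwise _≼_

  refines? : (ps qs : List (Flag k)) → Dec (Refines ps qs)
  refines? = Pointwise.decidable _≼?_

  refines-refl : ∀ ps → Refines ps ps
  refines-refl _ = Pointwise.refl (refl , λ b → b)

  refines-++⁻ : ∀ {n} as {cs F} → length as ≡ n → Refines (as ++ cs) F →
                Refines as (take n F) × Refines cs (drop n F)
  refines-++⁻ []       refl r       = [] , r
  refines-++⁻ (a ∷ as) refl (x ∷ r) = let r₁ , r₂ = refines-++⁻ as refl r in x ∷ r₁ , r₂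

  refines-∷ʳ⁻ : ∀ as bs {p q} → Refines (as ∷ʳ p) (bs ∷ʳ q) → Refines as bs × p ≼ q
  refines-∷ʳ⁻ []            []             (x ∷ [])  = [] , x
  refines-∷ʳ⁻ []            (_ ∷ [])       (_ ∷ ())
  refines-∷ʳ⁻ []            (_ ∷ _ ∷ _)    (_ ∷ ())
  refines-∷ʳ⁻ (_ ∷ [])      []             (_ ∷ ())
  refines-∷ʳ⁻ (_ ∷ _ ∷ _)   []             (_ ∷ ())
  refines-∷ʳ⁻ (a ∷ as)      (b ∷ bs)       (x ∷ r)   = let r′ , y = refines-∷ʳ⁻ as bs r in x ∷ r′ , y

  refines-[]⁻ : ∀ {xs} → Refines xs [] → xs ≡ []
  refines-[]⁻ [] = refl

  refines-[]ˡ⁻ : ∀ {ys} → Refines [] ys → ys ≡ []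
  refines-[]ˡ⁻ [] = refl

  wordFlags-length : ∀ b (w : Word k) → length (wordFlags b w) ≡ length w
  wordFlags-length b []      = refl
  wordFlags-length b (c ∷ w) = cong suc (wordFlags-length false w)

  flags-length : ∀ (J : Sentence k) → length (flags J) ≡ size J
  flags-length []      = refl
  flags-length (w ∷ J) =
    trans (ListP.length-++ (wordFlags true w)) (cong₂ _+_ (wordFlags-length true w) (flags-length J))

  wordFlags-++ : ∀ b (w x : Word k) → w ≢ [] → wordFlags b (w ++ x) ≡ wordFlags b w ++ wordFlags false x
  wordFlags-++ b []           x ne = ⊥-elim (ne refl)
  wordFlags-++ b (c ∷ [])     x ne = refl
  wordFlags-++ b (c ∷ c′ ∷ w) x ne = cong ((c , b) ∷_) (wordFlags-++ false (c′ ∷ w) x (λ ()))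

  ++-≢[] : ∀ {a} {A : Set a} (xs ys : List A) → xs ≢ [] → xs ++ ys ≢ []
  ++-≢[] []       ys h = ⊥-elim (h refl)
  ++-≢[] (x ∷ xs) ys h ()

  mergeAt-head : ∀ v (J : Sentence k) S → Σ (Word k) λ y → Σ (Sentence k) λ I → mergeAt (v ∷ J) S ≡ (v ++ y) ∷ I
  mergeAt-head v []       S           = [] , [] , cong (_∷ []) (sym (ListP.++-identityʳ v))
  mergeAt-head v (v′ ∷ J) (false ∷ S) = [] , mergeAt (v′ ∷ J) S , cong (_∷ _) (sym (ListP.++-identityʳ v))
  mergeAt-head v (v′ ∷ J) (true ∷ S)  with mergeAt (v′ ∷ J) S | mergeAt-head v′ J S
  ... | _ | y , I , refl = v′ ++ y , I , refl

  mergeAt-isSentence : ∀ (J : Sentence k) S → IsSentence J → IsSentence (mergeAt J S)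
  mergeAt-isSentence []          S           p        = []
  mergeAt-isSentence (w ∷ [])    S           p        = p
  mergeAt-isSentence (w ∷ v ∷ J) (false ∷ S) (pw ∷ p) = pw ∷ mergeAt-isSentence (v ∷ J) S p
  mergeAt-isSentence (w ∷ v ∷ J) (true ∷ S)  (pw ∷ p)
    with mergeAt (v ∷ J) S | mergeAt-head v J S | mergeAt-isSentence (v ∷ J) S p
  ... | _ | y , I , refl | _ ∷ q = ++-≢[] w _ pw ∷ q

  mergeAt-refines : ∀ (J : Sentence k) S → IsSentence J → Refines (flags J) (flags (mergeAt J S))
  mergeAt-refines []          S           p        = []
  mergeAt-refines (w ∷ [])    S           p        = refines-refl _
  mergeAt-refines (w ∷ v ∷ J) (false ∷ S) (pw ∷ p) =
    Pointwise.++⁺ (refines-refl (wordFlags true w)) (mergeAt-refines (v ∷ J) S p)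
  mergeAt-refines (w ∷ v ∷ J) (true ∷ S)  (pw ∷ p)
    with mergeAt (v ∷ J) S | mergeAt-head v J S | mergeAt-refines (v ∷ J) S p
  ... | _ | y , I , refl | ih
    rewrite wordFlags-++ true w (v ++ y) pw | ListP.++-assoc (wordFlags true w) (wordFlags false (v ++ y)) (flags I) =
    Pointwise.++⁺ (refines-refl (wordFlags true w)) (dropStart (v ++ y) (flags I) ih)
    where
    dropStart : ∀ {ps} (x : Word k) R → Refines ps (wordFlags true x ++ R) → Refines ps (wordFlags false x ++ R)
    dropStart []      R r              = r
    dropStart (c ∷ x) R ((e , _) ∷ r) = (e , λ ()) ∷ r

  ⪯⇒refines : ∀ {J I : Sentence k} → IsSentence J → J ⪯ I → Refines (flags J) (flags I)
  ⪯⇒refines {J} p (S , refl) = mergeAt-refines J S p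

  ⪯⇒size≡ : ∀ {J I : Sentence k} → IsSentence J → J ⪯ I → size J ≡ size I
  ⪯⇒size≡ {J} {I} p q =
    trans (sym (flags-length J)) (trans (Pointwise.Pointwise-length (⪯⇒refines p q)) (flags-length I))

  startsWord : List (Flag k) → Bool
  startsWord []            = true
  startsWord ((_ , b) ∷ _) = b

  setStart : Bool → List (Flag k) → List (Flag k)
  setStart b []             = []
  setStart b ((c , _) ∷ ps) = (c , b) ∷ ps

  consLetter : Fin k → Bool → Sentence k → Sentence k
  consLetter c true  S       = (c ∷ []) ∷ S
  consLetter c false []      = (c ∷ []) ∷ []
  consLetter c false (w ∷ S) = (c ∷ w) ∷ S

  unflags : List (Flag k) → Sentence k
  unflags []             = []
  unflags ((c , _) ∷ ps) = consLetter c (startsWord ps) (unflags ps)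

  startsWord-flags : ∀ (I : Sentence k) → IsSentence I → startsWord (flags I) ≡ true
  startsWord-flags []            _       = refl
  startsWord-flags ([] ∷ I)      (p ∷ _) = ⊥-elim (p refl)
  startsWord-flags ((c ∷ w) ∷ I) _       = refl

  setStart-flags : ∀ (I : Sentence k) → IsSentence I → setStart true (flags I) ≡ flags I
  setStart-flags []            _       = refl
  setStart-flags ([] ∷ I)      (p ∷ _) = ⊥-elim (p refl)
  setStart-flags ((c ∷ w) ∷ I) _       = refl

  unflags-flags : ∀ (I : Sentence k) → IsSentence I → unflags (flags I) ≡ I
  unflags-flags []            _       = refl
  unflags-flags ([] ∷ I)      (p ∷ _) = ⊥-elim (p refl)
  unflags-flags ((c ∷ w) ∷ I) (_ ∷ p) = firstWord c true w
    where
    firstWord : ∀ c b w → unflags (wordFlags b (c ∷ w) ++ flags I) ≡ (c ∷ w) ∷ I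
    firstWord c b []       rewrite startsWord-flags I p | unflags-flags I p = refl
    firstWord c b (c′ ∷ w) rewrite firstWord c′ false w = refl

  flags-injective : ∀ {I I′ : Sentence k} → IsSentence I → IsSentence I′ → flags I ≡ flags I′ → I ≡ I′
  flags-injective {I} {I′} p p′ e = begin
    I                 ≡⟨ unflags-flags I p ⟨
    unflags (flags I)  ≡⟨ cong unflags e ⟩
    unflags (flags I′) ≡⟨ unflags-flags I′ p′ ⟩
    I′                ∎
    where open ≡-Reasoning

  wordFlags-refines : ∀ b (w : Word k) {G} → Refines (wordFlags b w) G → G ≡ wordFlags (startsWord G) w
  wordFlags-refines b []      []                                    = refl
  wordFlags-refines b (c ∷ w) {(_ , _) ∷ G} ((refl , _) ∷ r) = cong (_ ∷_) (inner w r)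
    where
    inner : ∀ (w : Word k) {G} → Refines (wordFlags false w) G → G ≡ wordFlags false w
    inner []      []                                 = refl
    inner (c ∷ w) {(_ , false) ∷ G} ((refl , _) ∷ r) = cong (_ ∷_) (inner w r)
    inner (c ∷ w) {(_ , true) ∷ G}  ((refl , h) ∷ r) with () ← h refl

  setStart-wordFlags : ∀ b (w : Word k) R → w ≢ [] → setStart true (wordFlags b w ++ R) ≡ wordFlags true w ++ R
  setStart-wordFlags b []      R h = ⊥-elim (h refl)
  setStart-wordFlags b (c ∷ w) R h = refl

  unsetStart-wordFlags : ∀ (x : Word k) R {c Q} → x ≢ [] → wordFlags true x ++ R ≡ (c , true) ∷ Q →
                          wordFlags false x ++ R ≡ (c , false) ∷ Q
  unsetStart-wordFlags []       R h _    = ⊥-elim (h refl)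
  unsetStart-wordFlags (c′ ∷ x) R h refl = refl

  -- the gap after a word is merged exactly when the next letter of F does not begin a word
  mergeGaps : (J : Sentence k) → List (Flag k) → Vec Bool (pred (length J))
  mergeGaps []          F = []
  mergeGaps (w ∷ [])    F = []
  mergeGaps (w ∷ v ∷ J) F = not (startsWord (drop (length w) F)) ∷ mergeGaps (v ∷ J) (drop (length w) F)

  mergeAt-mergeGaps : ∀ (J : Sentence k) F → IsSentence J → J ≢ [] → Refines (flags J) F →
                      flags (mergeAt J (mergeGaps J F)) ≡ setStart true F
  mergeAt-mergeGaps []          F p        ne r = ⊥-elim (ne refl)
  mergeAt-mergeGaps (w ∷ [])    F (pw ∷ _) ne r
    rewrite ListP.++-identityʳ (wordFlags true w) | wordFlags-refines true w r =
    sym (setStart-word w pw)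
    where
    setStart-word : ∀ {b} (w : Word k) → w ≢ [] → setStart true (wordFlags b w) ≡ wordFlags true w
    setStart-word []      h = ⊥-elim (h refl)
    setStart-word (c ∷ w) h = refl
  mergeAt-mergeGaps (w ∷ v ∷ J) F (pw ∷ p@(pv ∷ _)) ne r = begin
    flags (mergeAt (w ∷ v ∷ J) (not (startsWord F₂) ∷ mergeGaps (v ∷ J) F₂))
      ≡⟨ mergeAt-step F₂ r₂ (mergeAt-mergeGaps (v ∷ J) F₂ p (λ ()) r₂) ⟩
    wordFlags true w ++ F₂
      ≡⟨ setStart-wordFlags (startsWord F₁) w F₂ pw ⟨
    setStart true (wordFlags (startsWord F₁) w ++ F₂)
      ≡⟨ cong (λ G → setStart true (G ++ F₂)) (wordFlags-refines true w r₁) ⟨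
    setStart true (F₁ ++ F₂)
      ≡⟨ cong (setStart true) (ListP.take++drop≡id (length w) F) ⟩
    setStart true F
      ∎
    where
    open ≡-Reasoning
    F₁ = take (length w) F
    F₂ = drop (length w) F
    split = refines-++⁻ (wordFlags true w) (wordFlags-length true w) r
    r₁ = proj₁ split
    r₂ = proj₂ split
    mergeAt-step : ∀ G → Refines (flags (v ∷ J)) G →
                   flags (mergeAt (v ∷ J) (mergeGaps (v ∷ J) G)) ≡ setStart true G →
                   flags (mergeAt (w ∷ v ∷ J) (not (startsWord G) ∷ mergeGaps (v ∷ J) G)) ≡ wordFlags true w ++ G
    mergeAt-step [] r′ _ = ⊥-elim (noLetters v pv r′)
      where
      noLetters : ∀ v → v ≢ [] → ¬ Refines (flags (v ∷ J)) []
      noLetters []      h _ = h refl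
      noLetters (c ∷ v) h ()
    mergeAt-step ((c , true) ∷ G) _ ih = cong (wordFlags true w ++_) ih
    mergeAt-step ((c , false) ∷ G) _ ih
      with mergeAt (v ∷ J) (mergeGaps (v ∷ J) ((c , false) ∷ G)) | mergeAt-head v J (mergeGaps (v ∷ J) ((c , false) ∷ G))
    ... | _ | y , I , refl
      rewrite wordFlags-++ true w (v ++ y) pw | ListP.++-assoc (wordFlags true w) (wordFlags false (v ++ y)) (flags I) =
      cong (wordFlags true w ++_) (unsetStart-wordFlags (v ++ y) (flags I) (++-≢[] v y pv) ih)

  refines⇒⪯ : ∀ {J I : Sentence k} → IsSentence J → IsSentence I → Refines (flags J) (flags I) → J ⪯ I
  refines⇒⪯ {[]}    {[]}          p q        r  = [] , refl
  refines⇒⪯ {[]}    {[] ∷ I}      p (q ∷ _) r  = ⊥-elim (q refl)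
  refines⇒⪯ {[]}    {(c ∷ w) ∷ I} p q        ()
  refines⇒⪯ {w ∷ J} {I}           p q        r  =
    mergeGaps (w ∷ J) (flags I) ,
    flags-injective (mergeAt-isSentence (w ∷ J) _ p) q
      (trans (mergeAt-mergeGaps (w ∷ J) (flags I) p (λ ()) r) (setStart-flags I q))

-- The coefficients of M_J and F_C

_≟ᴸ_ : ∀ {m} (xs ys : List (Fin m)) → Dec (xs ≡ ys)
_≟ᴸ_ = ListP.≡-dec _≟ᶠ_

-- the empty words of a monomial carry no information: M_J contains u exactly when
-- J lists the nonempty components of u and the indices are their positions
module _ {k : ℕ} where

  nonemptyWords : ∀ {m} → Mono k m → Sentence k
  nonemptyWords []            = []
  nonemptyWords ([] ∷ u)      = nonemptyWords u
  nonemptyWords ((c ∷ w) ∷ u) = (c ∷ w) ∷ nonemptyWords u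

  nonemptyIndices : ∀ {m} → Mono k m → List (Fin m)
  nonemptyIndices []            = []
  nonemptyIndices ([] ∷ u)      = map fsuc (nonemptyIndices u)
  nonemptyIndices ((c ∷ w) ∷ u) = fzero ∷ map fsuc (nonemptyIndices u)

  nonemptyWords-isSentence : ∀ {m} (u : Mono k m) → IsSentence (nonemptyWords u)
  nonemptyWords-isSentence []            = []
  nonemptyWords-isSentence ([] ∷ u)      = nonemptyWords-isSentence u
  nonemptyWords-isSentence ((c ∷ w) ∷ u) = (λ ()) ∷ nonemptyWords-isSentence u

  length-nonemptyIndices : ∀ {m} (u : Mono k m) → length (nonemptyIndices u) ≡ length (nonemptyWords u)
  length-nonemptyIndices []            = refl
  length-nonemptyIndices ([] ∷ u)      = trans (ListP.length-map fsuc (nonemptyIndices u)) (length-nonemptyIndices u)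
  length-nonemptyIndices ((c ∷ w) ∷ u) =
    cong suc (trans (ListP.length-map fsuc (nonemptyIndices u)) (length-nonemptyIndices u))

  map-fsuc-increasing : ∀ {m} {ks : List (Fin m)} → Linked F._<_ ks → Linked F._<_ (map fsuc ks)
  map-fsuc-increasing []      = []
  map-fsuc-increasing [-]     = [-]
  map-fsuc-increasing (h ∷ l) = s≤s h ∷ map-fsuc-increasing l

  nonemptyIndices-increasing : ∀ {m} (u : Mono k m) → Linked F._<_ (nonemptyIndices u)
  nonemptyIndices-increasing []            = []
  nonemptyIndices-increasing ([] ∷ u)      = map-fsuc-increasing (nonemptyIndices-increasing u)
  nonemptyIndices-increasing ((c ∷ w) ∷ u) with nonemptyIndices u | nonemptyIndices-increasing u
  ... | []     | _ = [-]
  ... | j ∷ js | l = s≤s z≤n ∷ map-fsuc-increasing l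

  tabulate-[] : ∀ {m} → tabulate (λ (_ : Fin m) → []) ≡ oneM {k} {m}
  tabulate-[] {zero}  = refl
  tabulate-[] {suc m} = cong ([] ∷_) tabulate-[]

  oneM-· : ∀ {m} (v : Mono k m) → oneM · v ≡ v
  oneM-· []      = refl
  oneM-· (x ∷ v) = cong (x ∷_) (oneM-· v)

  termM-fsuc : ∀ {m} (J : Sentence k) (ks : List (Fin m)) → termM J (map fsuc ks) ≡ [] ∷ termM J ks
  termM-fsuc []      ks       = refl
  termM-fsuc (w ∷ J) []       = refl
  termM-fsuc (w ∷ J) (j ∷ ks) rewrite termM-fsuc J ks = refl

  termM-fzero : ∀ {m} w (J : Sentence k) (ks : List (Fin m)) →
                termM (w ∷ J) (fzero ∷ map fsuc ks) ≡ w ∷ termM J ks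
  termM-fzero w J ks rewrite termM-fsuc J ks =
    cong₂ _∷_ (ListP.++-identityʳ w) (trans (cong (_· termM J ks) tabulate-[]) (oneM-· (termM J ks)))

  termM-nonempty : ∀ {m} (u : Mono k m) → termM (nonemptyWords u) (nonemptyIndices u) ≡ u
  termM-nonempty []            = refl
  termM-nonempty ([] ∷ u)      =
    trans (termM-fsuc (nonemptyWords u) (nonemptyIndices u)) (cong ([] ∷_) (termM-nonempty u))
  termM-nonempty ((c ∷ w) ∷ u) =
    trans (termM-fzero (c ∷ w) (nonemptyWords u) (nonemptyIndices u)) (cong ((c ∷ w) ∷_) (termM-nonempty u))

  increasing-view : ∀ {m} (js : List (Fin (suc m))) → Linked F._<_ js →
                    Σ (List (Fin m)) λ ks → Linked F._<_ ks × (js ≡ map fsuc ks ⊎ js ≡ fzero ∷ map fsuc ks)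
  increasing-view []               _ = [] , [] , inj₁ refl
  increasing-view (fzero ∷ [])     _ = [] , [] , inj₂ refl
  increasing-view (fsuc j ∷ [])    _ = j ∷ [] , [-] , inj₁ refl
  increasing-view (j ∷ j₂ ∷ js) (h ∷ l) with increasing-view (j₂ ∷ js) l
  ... | [] , _ , inj₁ ()
  ... | ks , _ , inj₂ refl with () ← h
  ... | k′ ∷ ks , lks , inj₁ refl with j | h
  ...   | fzero  | _       = k′ ∷ ks , lks , inj₂ refl
  ...   | fsuc i | s≤s i<k = i ∷ k′ ∷ ks , i<k ∷ lks , inj₁ refl

  termM≡⇒nonempty : ∀ {m} (J : Sentence k) → IsSentence J → (js : List (Fin m)) → Linked F._<_ js →
                    length js ≡ length J → (u : Mono k m) → termM J js ≡ u →
                    J ≡ nonemptyWords u × js ≡ nonemptyIndices u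
  termM≡⇒nonempty {zero}  []      p []        l e [] t = refl , refl
  termM≡⇒nonempty {zero}  (w ∷ J) p []        l () u t
  termM≡⇒nonempty {suc m} J       p js        l e (u₀ ∷ u) t with increasing-view js l
  ... | ks , lks , inj₁ refl
    with refl ← VecP.∷-injectiveˡ (trans (sym (termM-fsuc J ks)) t) =
    let J≡ , ks≡ = termM≡⇒nonempty J p ks lks (trans (sym (ListP.length-map fsuc ks)) e) u
                     (VecP.∷-injectiveʳ (trans (sym (termM-fsuc J ks)) t))
    in J≡ , cong (map fsuc) ks≡
  termM≡⇒nonempty {suc m} (w ∷ J) (pw ∷ p) js l e (u₀ ∷ u) t | ks , lks , inj₂ refl
    with refl ← VecP.∷-injectiveˡ (trans (sym (termM-fzero w J ks)) t) =
    let J≡ , ks≡ = termM≡⇒nonempty J p ks lks (trans (sym (ListP.length-map fsuc ks)) (ℕ.suc-injective e)) u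
                     (VecP.∷-injectiveʳ (trans (sym (termM-fzero w J ks)) t))
    in nonemptyHead w pw J≡ ks≡
    where
    nonemptyHead : ∀ w → w ≢ [] → J ≡ nonemptyWords u → ks ≡ nonemptyIndices u →
                   w ∷ J ≡ nonemptyWords (w ∷ u) × fzero ∷ map fsuc ks ≡ nonemptyIndices (w ∷ u)
    nonemptyHead []      h _   _   = ⊥-elim (h refl)
    nonemptyHead (c ∷ w) h J≡ ks≡ = cong ((c ∷ w) ∷_) J≡ , cong (λ z → fzero ∷ map fsuc z) ks≡

  ∑-allLists-cong : ∀ m l {f g : List (Fin m) → ℕ} → (∀ ys → length ys ≡ l → f ys ≡ g ys) →
                    ∑ (allLists m l) f ≡ ∑ (allLists m l) g
  ∑-allLists-cong m zero    e = cong (_+ 0) (e [] refl)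
  ∑-allLists-cong m (suc l) {f} {g} e = begin
    ∑ (allLists m (suc l)) f
      ≡⟨ ∑-concatMap (λ i → map (i ∷_) (allLists m l)) (allFin m) f ⟩
    ∑ (allFin m) (λ i → ∑ (map (i ∷_) (allLists m l)) f)
      ≡⟨ ∑-cong (allFin m) (λ i → trans (∑-map (i ∷_) (allLists m l) f)
                                 (trans (∑-allLists-cong m l (λ ys h → e (i ∷ ys) (cong suc h)))
                                        (sym (∑-map (i ∷_) (allLists m l) g)))) ⟩
    ∑ (allFin m) (λ i → ∑ (map (i ∷_) (allLists m l)) g)
      ≡⟨ ∑-concatMap (λ i → map (i ∷_) (allLists m l)) (allFin m) g ⟨
    ∑ (allLists m (suc l)) g
      ∎
    where open ≡-Reasoning

  ∑-allLists-𝟙≡ : ∀ m (xs : List (Fin m)) → ∑ (allLists m (length xs)) (λ ys → 𝟙 (ys ≟ᴸ xs)) ≡ 1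
  ∑-allLists-𝟙≡ m []       = refl
  ∑-allLists-𝟙≡ m (x ∷ xs) = begin
    ∑ (allLists m (suc (length xs))) (λ ys → 𝟙 (ys ≟ᴸ (x ∷ xs)))
      ≡⟨ ∑-concatMap (λ i → map (i ∷_) (allLists m (length xs))) (allFin m) _ ⟩
    ∑ (allFin m) (λ i → ∑ (map (i ∷_) (allLists m (length xs))) (λ ys → 𝟙 (ys ≟ᴸ (x ∷ xs))))
      ≡⟨ ∑-cong (allFin m) (λ i → trans (∑-map (i ∷_) (allLists m (length xs)) _) (headCase i)) ⟩
    ∑ (allFin m) (λ i → 𝟙 (i ≟ᶠ x) * 1)
      ≡⟨ ∑-allFin-𝟙≡ m x (λ _ → 1) ⟩
    1 ∎
    where
    open ≡-Reasoning
    headCase : ∀ i → ∑ (allLists m (length xs)) (λ ys → 𝟙 ((i ∷ ys) ≟ᴸ (x ∷ xs))) ≡ 𝟙 (i ≟ᶠ x) * 1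
    headCase i = begin
      ∑ (allLists m (length xs)) (λ ys → 𝟙 ((i ∷ ys) ≟ᴸ (x ∷ xs)))
        ≡⟨ ∑-cong (allLists m (length xs)) (λ ys →
             trans (𝟙-cong ((i ∷ ys) ≟ᴸ (x ∷ xs)) ((i ≟ᶠ x) ×-dec (ys ≟ᴸ xs))
                     ListP.∷-injective (λ { (refl , refl) → refl }))
                   (𝟙-× (i ≟ᶠ x) (ys ≟ᴸ xs))) ⟩
      ∑ (allLists m (length xs)) (λ ys → 𝟙 (i ≟ᶠ x) * 𝟙 (ys ≟ᴸ xs))
        ≡⟨ ∑-*ˡ (allLists m (length xs)) (𝟙 (i ≟ᶠ x)) _ ⟩
      𝟙 (i ≟ᶠ x) * ∑ (allLists m (length xs)) (λ ys → 𝟙 (ys ≟ᴸ xs))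
        ≡⟨ cong (𝟙 (i ≟ᶠ x) *_) (∑-allLists-𝟙≡ m xs) ⟩
      𝟙 (i ≟ᶠ x) * 1 ∎

  coeffM≡𝟙 : ∀ {m} (J : Sentence k) → IsSentence J → (u : Mono k m) →
             coeffM J u ≡ 𝟙 (sent-≟ J (nonemptyWords u))
  coeffM≡𝟙 {m} J p u = begin
    coeffM J u
      ≡⟨ count≡∑𝟙 _ (filter (linked? F._<?_) lists) ⟩
    ∑ (filter (linked? F._<?_) lists) (λ js → 𝟙 (mono-≟ (termM J js) u))
      ≡⟨ ∑-filter (linked? F._<?_) lists _ ⟩
    ∑ lists (λ js → 𝟙 (linked? F._<?_ js) * 𝟙 (mono-≟ (termM J js) u))
      ≡⟨ ∑-allLists-cong m (length J) term ⟩
    ∑ lists (λ js → 𝟙 J? * 𝟙 (js ≟ᴸ nonemptyIndices u))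
      ≡⟨ ∑-*ˡ lists (𝟙 J?) _ ⟩
    𝟙 J? * ∑ lists (λ js → 𝟙 (js ≟ᴸ nonemptyIndices u))
      ≡⟨ uniqueIndices J? ⟩
    𝟙 J? ∎
    where
    open ≡-Reasoning
    lists = allLists m (length J)
    J? = sent-≟ J (nonemptyWords u)
    term : ∀ js → length js ≡ length J →
           𝟙 (linked? F._<?_ js) * 𝟙 (mono-≟ (termM J js) u) ≡ 𝟙 J? * 𝟙 (js ≟ᴸ nonemptyIndices u)
    term js h with linked? F._<?_ js
    ... | yes l = trans (ℕ.+-identityʳ _)
                    (trans (𝟙-cong (mono-≟ (termM J js) u) (J? ×-dec (js ≟ᴸ nonemptyIndices u))
                              (termM≡⇒nonempty J p js l h u) (λ { (refl , refl) → termM-nonempty u }))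
                           (𝟙-× J? (js ≟ᴸ nonemptyIndices u)))
    ... | no ¬l = sym (trans (cong (𝟙 J? *_) (𝟙-no (js ≟ᴸ nonemptyIndices u)
                                                   (λ { refl → ¬l (nonemptyIndices-increasing u) })))
                             (ℕ.*-zeroʳ (𝟙 J?)))
    uniqueIndices : (d : Dec (J ≡ nonemptyWords u)) → 𝟙 d * ∑ lists (λ js → 𝟙 (js ≟ᴸ nonemptyIndices u)) ≡ 𝟙 d
    uniqueIndices (yes refl) =
      trans (ℕ.+-identityʳ _)
            (trans (cong (λ l → ∑ (allLists m l) (λ js → 𝟙 (js ≟ᴸ nonemptyIndices u))) (sym (length-nonemptyIndices u)))
                   (∑-allLists-𝟙≡ m (nonemptyIndices u)))
    uniqueIndices (no _) = refl

  ∑-sentencesOfSize-cong : ∀ n {f g : Sentence k → ℕ} → (∀ J → IsSentence J → f J ≡ g J) →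
                           ∑ (sentencesOfSize k n) f ≡ ∑ (sentencesOfSize k n) g
  ∑-sentencesOfSize-cong zero    e = cong (_+ 0) (e [] [])
  ∑-sentencesOfSize-cong (suc n) {f} {g} e = begin
    ∑ (sentencesOfSize k (suc n)) f
      ≡⟨ ∑-concatMap extensions (sentencesOfSize k n) f ⟩
    ∑ (sentencesOfSize k n) (λ s → ∑ (extensions s) f)
      ≡⟨ ∑-sentencesOfSize-cong n (λ s ps → trans (∑-concatMap (λ c → extendBy c s) (allFin k) f)
                                          (trans (∑-cong (allFin k) (λ c → ∑-extendBy-cong c s ps))
                                                 (sym (∑-concatMap (λ c → extendBy c s) (allFin k) g)))) ⟩
    ∑ (sentencesOfSize k n) (λ s → ∑ (extensions s) g)
      ≡⟨ ∑-concatMap extensions (sentencesOfSize k n) g ⟨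
    ∑ (sentencesOfSize k (suc n)) g ∎
    where
    open ≡-Reasoning
    extensions : Sentence k → List (Sentence k)
    extensions s = concatMap (λ c → extendBy c s) (allFin k)
    ∑-extendBy-cong : ∀ c s → IsSentence s → ∑ (extendBy c s) f ≡ ∑ (extendBy c s) g
    ∑-extendBy-cong c []       ps       = cong (_+ 0) (e _ ((λ ()) ∷ []))
    ∑-extendBy-cong c (v ∷ vs) (pv ∷ ps) =
      cong₂ _+_ (e _ ((λ ()) ∷ pv ∷ ps)) (cong (_+ 0) (e _ ((λ ()) ∷ ps)))

  dropFirstLetter : Word k → Sentence k → Sentence k
  dropFirstLetter []      I = I
  dropFirstLetter (x ∷ w) I = (x ∷ w) ∷ I

  ∑-extendBy-𝟙≡ : ∀ c s → IsSentence s → ∀ c₀ w I →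
                  ∑ (extendBy c s) (λ J → 𝟙 (sent-≟ J ((c₀ ∷ w) ∷ I))) ≡
                  𝟙 (c ≟ᶠ c₀) * 𝟙 (sent-≟ s (dropFirstLetter w I))
  ∑-extendBy-𝟙≡ c [] ps c₀ [] I =
    trans (ℕ.+-identityʳ _)
          (trans (𝟙-cong (sent-≟ ((c ∷ []) ∷ []) ((c₀ ∷ []) ∷ I)) ((c ≟ᶠ c₀) ×-dec sent-≟ [] I)
                    (λ { refl → refl , refl }) (λ { (refl , refl) → refl }))
                 (𝟙-× (c ≟ᶠ c₀) (sent-≟ [] I)))
  ∑-extendBy-𝟙≡ c [] ps c₀ (x ∷ w) I =
    trans (ℕ.+-identityʳ _)
          (trans (𝟙-no (sent-≟ ((c ∷ []) ∷ []) ((c₀ ∷ x ∷ w) ∷ I)) (λ ()))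
                 (sym (trans (cong (𝟙 (c ≟ᶠ c₀) *_) (𝟙-no (sent-≟ [] ((x ∷ w) ∷ I)) λ ()))
                             (ℕ.*-zeroʳ (𝟙 (c ≟ᶠ c₀))))))
  ∑-extendBy-𝟙≡ c (v ∷ vs) (pv ∷ ps) c₀ [] I =
    trans (cong₂ _+_ (trans (𝟙-cong (sent-≟ ((c ∷ []) ∷ v ∷ vs) ((c₀ ∷ []) ∷ I)) ((c ≟ᶠ c₀) ×-dec sent-≟ (v ∷ vs) I)
                               (λ { refl → refl , refl }) (λ { (refl , refl) → refl }))
                            (𝟙-× (c ≟ᶠ c₀) (sent-≟ (v ∷ vs) I)))
                     (trans (ℕ.+-identityʳ _) (𝟙-no (sent-≟ ((c ∷ v) ∷ vs) ((c₀ ∷ []) ∷ I)) (λ { refl → pv refl }))))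
          (ℕ.+-identityʳ _)
  ∑-extendBy-𝟙≡ c (v ∷ vs) (pv ∷ ps) c₀ (x ∷ w) I =
    cong₂ _+_ (𝟙-no (sent-≟ ((c ∷ []) ∷ v ∷ vs) ((c₀ ∷ x ∷ w) ∷ I)) (λ ()))
              (trans (ℕ.+-identityʳ _)
                     (trans (𝟙-cong (sent-≟ ((c ∷ v) ∷ vs) ((c₀ ∷ x ∷ w) ∷ I))
                                    ((c ≟ᶠ c₀) ×-dec sent-≟ (v ∷ vs) ((x ∷ w) ∷ I))
                                    (λ { refl → refl , refl }) (λ { (refl , refl) → refl }))
                            (𝟙-× (c ≟ᶠ c₀) (sent-≟ (v ∷ vs) ((x ∷ w) ∷ I)))))

  dropFirstLetter-isSentence : ∀ c₀ w I → IsSentence ((c₀ ∷ w) ∷ I) → IsSentence (dropFirstLetter w I)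
  dropFirstLetter-isSentence c₀ []      I (_ ∷ p) = p
  dropFirstLetter-isSentence c₀ (x ∷ w) I (_ ∷ p) = (λ ()) ∷ p

  size-dropFirstLetter : ∀ c₀ w I → size ((c₀ ∷ w) ∷ I) ≡ suc (size (dropFirstLetter w I))
  size-dropFirstLetter c₀ []      I = refl
  size-dropFirstLetter c₀ (x ∷ w) I = refl

  ∑-sentencesOfSize-𝟙≡ : ∀ n (I : Sentence k) → IsSentence I → size I ≡ n →
                         ∑ (sentencesOfSize k n) (λ J → 𝟙 (sent-≟ J I)) ≡ 1
  ∑-sentencesOfSize-𝟙≡ zero    []             p       e  = refl
  ∑-sentencesOfSize-𝟙≡ _       ([] ∷ I)       (h ∷ _) e  = ⊥-elim (h refl)
  ∑-sentencesOfSize-𝟙≡ zero    ((c ∷ w) ∷ I)  p       ()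
  ∑-sentencesOfSize-𝟙≡ (suc n) []             p       ()
  ∑-sentencesOfSize-𝟙≡ (suc n) ((c₀ ∷ w) ∷ I) p       e  = begin
    ∑ (sentencesOfSize k (suc n)) (λ J → 𝟙 (sent-≟ J ((c₀ ∷ w) ∷ I)))
      ≡⟨ ∑-concatMap (λ s → concatMap (λ c → extendBy c s) (allFin k)) (sentencesOfSize k n) _ ⟩
    ∑ (sentencesOfSize k n) (λ s → ∑ (concatMap (λ c → extendBy c s) (allFin k)) (λ J → 𝟙 (sent-≟ J ((c₀ ∷ w) ∷ I))))
      ≡⟨ ∑-sentencesOfSize-cong n (λ s ps →
           trans (∑-concatMap (λ c → extendBy c s) (allFin k) _)
                 (trans (∑-cong (allFin k) (λ c → ∑-extendBy-𝟙≡ c s ps c₀ w I))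
                        (∑-allFin-𝟙≡ k c₀ (λ _ → 𝟙 (sent-≟ s (dropFirstLetter w I)))))) ⟩
    ∑ (sentencesOfSize k n) (λ s → 𝟙 (sent-≟ s (dropFirstLetter w I)))
      ≡⟨ ∑-sentencesOfSize-𝟙≡ n (dropFirstLetter w I) (dropFirstLetter-isSentence c₀ w I p)
           (ℕ.suc-injective (trans (sym (size-dropFirstLetter c₀ w I)) e)) ⟩
    1 ∎
    where open ≡-Reasoning

  coeffF≡𝟙-⪯ : ∀ {m} (C : Sentence k) → IsSentence C → (u : Mono k m) →
               coeffF C u ≡ 𝟙 (nonemptyWords u ⪯? C)
  coeffF≡𝟙-⪯ {m} C pC u = begin
    coeffF C u
      ≡⟨ ∑-filter (_⪯? C) sentences (λ J → coeffM J u) ⟩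
    ∑ sentences (λ J → 𝟙 (J ⪯? C) * coeffM J u)
      ≡⟨ ∑-sentencesOfSize-cong (size C) (λ J pJ → trans (cong (𝟙 (J ⪯? C) *_) (coeffM≡𝟙 J pJ u)) (swap J)) ⟩
    ∑ sentences (λ J → 𝟙 (sent-≟ J v) * 𝟙 (v ⪯? C))
      ≡⟨ ∑-𝟙≡ sent-≟ sentences v (λ _ → 𝟙 (v ⪯? C)) ⟩
    count (λ J → sent-≟ J v) sentences * 𝟙 (v ⪯? C)
      ≡⟨ listedOnce (v ⪯? C) ⟩
    𝟙 (v ⪯? C) ∎
    where
    open ≡-Reasoning
    sentences = sentencesOfSize k (size C)
    v = nonemptyWords u
    swap : ∀ J → 𝟙 (J ⪯? C) * 𝟙 (sent-≟ J v) ≡ 𝟙 (sent-≟ J v) * 𝟙 (v ⪯? C)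
    swap J with sent-≟ J v
    ... | yes refl = ℕ.*-comm (𝟙 (v ⪯? C)) 1
    ... | no _     = ℕ.*-zeroʳ (𝟙 (J ⪯? C))
    listedOnce : (d : Dec (v ⪯ C)) → count (λ J → sent-≟ J v) sentences * 𝟙 d ≡ 𝟙 d
    listedOnce (yes q) =
      cong (_* 1) (trans (count≡∑𝟙 _ sentences)
                         (∑-sentencesOfSize-𝟙≡ (size C) v (nonemptyWords-isSentence u)
                                               (⪯⇒size≡ (nonemptyWords-isSentence u) q)))
    listedOnce (no _)  = ℕ.*-zeroʳ (count (λ J → sent-≟ J v) sentences)

  coeffF≡𝟙-refines : ∀ {m} (C : Sentence k) → IsSentence C → (u : Mono k m) →
                     coeffF C u ≡ 𝟙 (refines? (flags (nonemptyWords u)) (flags C))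
  coeffF≡𝟙-refines C pC u =
    trans (coeffF≡𝟙-⪯ C pC u)
          (𝟙-cong (nonemptyWords u ⪯? C) (refines? (flags (nonemptyWords u)) (flags C))
                  (⪯⇒refines (nonemptyWords-isSentence u)) (refines⇒⪯ (nonemptyWords-isSentence u) pC))

  descentFlagsAfter : ℕ → List (ℕ × Fin k) → List (Flag k)
  descentFlagsAfter r []              = []
  descentFlagsAfter r ((r′ , c) ∷ xs) = (c , (r <ᵇ r′)) ∷ descentFlagsAfter r′ xs

  descentFlags : List (ℕ × Fin k) → List (Flag k)
  descentFlags []             = []
  descentFlags ((r , c) ∷ xs) = (c , true) ∷ descentFlagsAfter r xs

  consHead-flags : ∀ c (S : Sentence k) → IsSentence S →
                   flags (consHead c S) ≡ (c , true) ∷ setStart false (flags S) × IsSentence (consHead c S)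
  consHead-flags c []            _       = refl , (λ ()) ∷ []
  consHead-flags c ([] ∷ S)      (h ∷ _) = ⊥-elim (h refl)
  consHead-flags c ((x ∷ w) ∷ S) (_ ∷ p) = refl , (λ ()) ∷ p

  coFrom-flags : ∀ (xs : List (ℕ × Fin k)) → flags (coFrom xs) ≡ descentFlags xs × IsSentence (coFrom xs)
  coFrom-flags []                          = refl , []
  coFrom-flags ((r , c) ∷ [])              = refl , (λ ()) ∷ []
  coFrom-flags ((r , c) ∷ (r′ , c′) ∷ xs) with coFrom-flags ((r′ , c′) ∷ xs)
  ... | ih , ps with r <ᵇ r′
  ... | true  = cong ((c , true) ∷_) ih , (λ ()) ∷ ps
  ... | false = let e , q = consHead-flags c (coFrom ((r′ , c′) ∷ xs)) ps
                in trans e (cong (λ z → (c , true) ∷ setStart false z) ih) , q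

  length-descentFlags : ∀ (xs : List (ℕ × Fin k)) → length (descentFlags xs) ≡ length xs
  length-descentFlags []             = refl
  length-descentFlags ((r , c) ∷ xs) = cong suc (after r xs)
    where
    after : ∀ r (xs : List (ℕ × Fin k)) → length (descentFlagsAfter r xs) ≡ length xs
    after r []              = refl
    after r ((r′ , c) ∷ xs) = cong suc (after r′ xs)

  size-coFrom : ∀ (xs : List (ℕ × Fin k)) → size (coFrom xs) ≡ length xs
  size-coFrom xs = begin
    size (coFrom xs)            ≡⟨ flags-length (coFrom xs) ⟨
    length (flags (coFrom xs))  ≡⟨ cong length (proj₁ (coFrom-flags xs)) ⟩
    length (descentFlags xs)    ≡⟨ length-descentFlags xs ⟩
    length xs                   ∎
    where open ≡-Reasoning

NonEmpty : ∀ {X : Set} → List X → Set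
NonEmpty w = w ≢ []

module _ {X : Set} where

  rowAt : List (List X) → ℕ → List X
  rowAt []      r       = []
  rowAt (t ∷ T) zero    = t
  rowAt (t ∷ T) (suc r) = rowAt T r

  -- appends x to row r; for r = length T it starts a new bottom row
  addBox : List (List X) → ℕ → X → List (List X)
  addBox []      zero    x = (x ∷ []) ∷ []
  addBox (t ∷ T) zero    x = (t ∷ʳ x) ∷ T
  addBox []      (suc r) x = []
  addBox (t ∷ T) (suc r) x = t ∷ addBox T r x

  dropLast : List X → List X
  dropLast []           = []
  dropLast (x ∷ [])     = []
  dropLast (x ∷ y ∷ xs) = x ∷ dropLast (y ∷ xs)

  consNonEmpty : List X → List (List X) → List (List X)
  consNonEmpty []       J = J
  consNonEmpty (a ∷ as) J = (a ∷ as) ∷ J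

  removeBox : List (List X) → ℕ → List (List X)
  removeBox []      r       = []
  removeBox (w ∷ J) zero    = consNonEmpty (dropLast w) J
  removeBox (w ∷ J) (suc r) = w ∷ removeBox J r

  -- the largest entry of a CIT can sit at the end of row r: the first column stays
  -- strictly increasing unless the row consists of that box alone and is not the bottom row
  Removable : List (List X) → ℕ → Set
  Removable []      r       = ⊥
  Removable (w ∷ J) zero    = (2 ≤ length w) ⊎ (length w ≡ 1 × J ≡ [])
  Removable (w ∷ J) (suc r) = Removable J r

  removable? : ∀ J r → Dec (Removable J r)
  removable? []      r       = no (λ ())
  removable? (w ∷ J) (suc r) = removable? J r
  removable? (w ∷ J) zero    with 2 ≤? length w | length w ℕ.≟ 1 | J
  ... | yes p | _     | _       = yes (inj₁ p)
  ... | no ¬p | yes e | []      = yes (inj₂ (e , refl))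
  ... | no ¬p | yes e | (_ ∷ _) = no λ { (inj₁ p) → ¬p p ; (inj₂ (_ , ())) }
  ... | no ¬p | no ¬e | _       = no λ { (inj₁ p) → ¬p p ; (inj₂ (e , _)) → ¬e e }

  dropLast-last : ∀ (w : List X) c → last w ≡ just c → w ≡ dropLast w ∷ʳ c
  dropLast-last (x ∷ [])     c refl = refl
  dropLast-last (x ∷ y ∷ xs) c e    = cong (x ∷_) (dropLast-last (y ∷ xs) c e)

  last-nonEmpty : ∀ (w : List X) → NonEmpty w → Σ X λ c → last w ≡ just c
  last-nonEmpty []           h = ⊥-elim (h refl)
  last-nonEmpty (x ∷ [])     h = x , refl
  last-nonEmpty (x ∷ y ∷ xs) h = last-nonEmpty (y ∷ xs) (λ ())

  length-dropLast : ∀ (w : List X) → NonEmpty w → length w ≡ suc (length (dropLast w))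
  length-dropLast []           h = ⊥-elim (h refl)
  length-dropLast (x ∷ [])     h = refl
  length-dropLast (x ∷ y ∷ xs) h = cong suc (length-dropLast (y ∷ xs) (λ ()))

  removeBox-removable : ∀ (J : List (List X)) r → All NonEmpty J → Removable J r →
                        Σ X λ c → last (rowAt J r) ≡ just c × addBox (removeBox J r) r c ≡ J ×
                                  All NonEmpty (removeBox J r) × r ≤ length (removeBox J r)
  removeBox-removable (w ∷ J) (suc r) (nw ∷ ne) v =
    let c , lc , e , ne′ , h = removeBox-removable J r ne v in c , lc , cong (w ∷_) e , nw ∷ ne′ , s≤s h
  removeBox-removable (w ∷ J) zero    (nw ∷ ne) v
    with c , lc ← last-nonEmpty w nw
    with dropLast w | dropLast-last w c lc | length-dropLast w nw
  ... | a ∷ as | w≡ | _ = c , lc , cong (_∷ J) (sym w≡) , (λ ()) ∷ ne , z≤n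
  ... | []     | w≡ | |w|≡1 with v
  ...   | inj₁ 2≤|w|        with () ← ℕ.<-irrefl refl (ℕ.≤-trans 2≤|w| (ℕ.≤-reflexive |w|≡1))
  ...   | inj₂ (_ , refl) = c , lc , cong (_∷ []) (sym w≡) , ne , z≤n

  take-addBox : ∀ (T : List (List X)) r x → r ≤ length T → take r (addBox T r x) ≡ take r T
  take-addBox T       zero    x _       = refl
  take-addBox (t ∷ T) (suc r) x (s≤s h) = cong (t ∷_) (take-addBox T r x h)

  rowAt-addBox : ∀ (T : List (List X)) r x → r ≤ length T → rowAt (addBox T r x) r ≡ rowAt T r ∷ʳ x
  rowAt-addBox []      zero    x _       = refl
  rowAt-addBox (t ∷ T) zero    x _       = refl
  rowAt-addBox (t ∷ T) (suc r) x (s≤s h) = rowAt-addBox T r x h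

  ∈-rowAt-addBox : ∀ (T : List (List X)) r x → r ≤ length T → Any (_≡ x) (rowAt (addBox T r x) r)
  ∈-rowAt-addBox T r x h = subst (Any (_≡ x)) (sym (rowAt-addBox T r x h)) (AnyP.++⁺ʳ (rowAt T r) (here refl))

  Any-rowAt⇒Any-concat : ∀ {P : X → Set} (T : List (List X)) r → Any P (rowAt T r) → Any P (concat T)
  Any-rowAt⇒Any-concat (t ∷ T) zero    a = AnyP.++⁺ˡ a
  Any-rowAt⇒Any-concat (t ∷ T) (suc r) a = AnyP.++⁺ʳ t (Any-rowAt⇒Any-concat T r a)

  All-rowAt : ∀ {P : List X → Set} (T : List (List X)) r → All P T → P [] → P (rowAt T r)
  All-rowAt []      r       a        p = p
  All-rowAt (t ∷ T) zero    (pt ∷ _) p = pt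
  All-rowAt (t ∷ T) (suc r) (_ ∷ a)  p = All-rowAt T r a p

  All-concat-addBox⁻ : ∀ {P : X → Set} (T : List (List X)) r x → r ≤ length T →
                       All P (concat (addBox T r x)) → All P (concat T) × P x
  All-concat-addBox⁻ []      zero    x _       (px ∷ []) = [] , px
  All-concat-addBox⁻ (t ∷ T) zero    x _       a
    with a₁ , a₂ ← AllP.++⁻ (t ∷ʳ x) a
    with a₁₁ , (px ∷ []) ← AllP.++⁻ t a₁ = AllP.++⁺ a₁₁ a₂ , px
  All-concat-addBox⁻ (t ∷ T) (suc r) x (s≤s h) a
    with a₁ , a₂ ← AllP.++⁻ t a
    with b , px ← All-concat-addBox⁻ T r x h a₂ = AllP.++⁺ a₁ b , px

  All-concat-addBox⁺ : ∀ {P : X → Set} (T : List (List X)) r x → r ≤ length T →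
                       All P (concat T) → P x → All P (concat (addBox T r x))
  All-concat-addBox⁺ []      zero    x _       a px = px ∷ []
  All-concat-addBox⁺ (t ∷ T) zero    x _       a px =
    let a₁ , a₂ = AllP.++⁻ t a in AllP.++⁺ (AllP.++⁺ a₁ (px ∷ [])) a₂
  All-concat-addBox⁺ (t ∷ T) (suc r) x (s≤s h) a px =
    let a₁ , a₂ = AllP.++⁻ t a in AllP.++⁺ a₁ (All-concat-addBox⁺ T r x h a₂ px)

  ∑-concat-addBox : ∀ (f : X → ℕ) (T : List (List X)) r x → r ≤ length T →
                    ∑ (concat (addBox T r x)) f ≡ ∑ (concat T) f + f x
  ∑-concat-addBox f []      zero    x _       = ℕ.+-identityʳ (f x)
  ∑-concat-addBox f (t ∷ T) zero    x _       = begin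
    ∑ ((t ∷ʳ x) ++ concat T) f        ≡⟨ cong (λ z → ∑ z f) (ListP.++-assoc t (x ∷ []) (concat T)) ⟩
    ∑ (t ++ x ∷ concat T) f           ≡⟨ ∑-++ t (x ∷ concat T) f ⟩
    ∑ t f + (f x + ∑ (concat T) f)    ≡⟨ cong (∑ t f +_) (ℕ.+-comm (f x) _) ⟩
    ∑ t f + (∑ (concat T) f + f x)    ≡⟨ ℕ.+-assoc (∑ t f) _ (f x) ⟨
    ∑ t f + ∑ (concat T) f + f x      ≡⟨ cong (_+ f x) (∑-++ t (concat T) f) ⟨
    ∑ (t ++ concat T) f + f x         ∎
    where open ≡-Reasoning
  ∑-concat-addBox f (t ∷ T) (suc r) x (s≤s h) = begin
    ∑ (t ++ concat (addBox T r x)) f      ≡⟨ ∑-++ t _ f ⟩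
    ∑ t f + ∑ (concat (addBox T r x)) f   ≡⟨ cong (∑ t f +_) (∑-concat-addBox f T r x h) ⟩
    ∑ t f + (∑ (concat T) f + f x)        ≡⟨ ℕ.+-assoc (∑ t f) _ (f x) ⟨
    ∑ t f + ∑ (concat T) f + f x          ≡⟨ cong (_+ f x) (∑-++ t (concat T) f) ⟨
    ∑ (t ++ concat T) f + f x             ∎
    where open ≡-Reasoning

  count-concat-addBox : ∀ {P : X → Set} (P? : Decidable P) (T : List (List X)) r x → r ≤ length T →
                        count P? (concat (addBox T r x)) ≡ count P? (concat T) + 𝟙 (P? x)
  count-concat-addBox P? T r x h = begin
    count P? (concat (addBox T r x))               ≡⟨ count≡∑𝟙 P? (concat (addBox T r x)) ⟩
    ∑ (concat (addBox T r x)) (λ y → 𝟙 (P? y))     ≡⟨ ∑-concat-addBox (λ y → 𝟙 (P? y)) T r x h ⟩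
    ∑ (concat T) (λ y → 𝟙 (P? y)) + 𝟙 (P? x)       ≡⟨ cong (_+ 𝟙 (P? x)) (count≡∑𝟙 P? (concat T)) ⟨
    count P? (concat T) + 𝟙 (P? x)                 ∎
    where open ≡-Reasoning

  Linked-++⁻ˡ : ∀ {R : X → X → Set} (A : List X) {B} → Linked R (A ++ B) → Linked R A
  Linked-++⁻ˡ []           l       = []
  Linked-++⁻ˡ (a ∷ [])     l       = [-]
  Linked-++⁻ˡ (a ∷ a′ ∷ A) (h ∷ l) = h ∷ Linked-++⁻ˡ (a′ ∷ A) l

  Linked-∷ʳ⁺ : ∀ {R : X → X → Set} (A : List X) x → Linked R A → All (λ e → R e x) A → Linked R (A ∷ʳ x)
  Linked-∷ʳ⁺ []           x l       a        = [-]
  Linked-∷ʳ⁺ (e ∷ [])     x l       (p ∷ []) = p ∷ [-]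
  Linked-∷ʳ⁺ (e ∷ e′ ∷ A) x (h ∷ l) (p ∷ ps) = h ∷ Linked-∷ʳ⁺ (e′ ∷ A) x l ps

  Linked-∷ʳ⇒≤last : ∀ {R : X → X → Set} → (∀ {a b c} → R a b → R b c → R a c) → (∀ {a} → R a a) →
                    ∀ (A : List X) x → Linked R (A ∷ʳ x) → All (λ e → R e x) (A ∷ʳ x)
  Linked-∷ʳ⇒≤last tr rf []           x _       = rf ∷ []
  Linked-∷ʳ⇒≤last tr rf (e ∷ [])     x (h ∷ _) = h ∷ rf ∷ []
  Linked-∷ʳ⇒≤last tr rf (e ∷ e′ ∷ A) x (h ∷ l)
    with q ∷ qs ← Linked-∷ʳ⇒≤last tr rf (e′ ∷ A) x l = tr h q ∷ q ∷ qs

size-addBox : ∀ {k} (J : Sentence k) r c → r ≤ length J → size (addBox J r c) ≡ suc (size J)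
size-addBox []      zero    c _       = refl
size-addBox (w ∷ J) zero    c _       = cong (_+ size J) (trans (ListP.length-++ w) (ℕ.+-comm (length w) 1))
size-addBox (w ∷ J) (suc r) c (s≤s h) = trans (cong (length w +_) (size-addBox J r c h)) (ℕ.+-suc (length w) _)

data Shape {k} {Y : Set} : Sentence k → List (List Y) → Set where
  []  : Shape [] []
  _∷_ : ∀ {w t J T} → length t ≡ length w → Shape J T → Shape (w ∷ J) (t ∷ T)

module _ {k : ℕ} {Y : Set} where

  Shape-length : ∀ {J : Sentence k} {T : List (List Y)} → Shape J T → length T ≡ length J
  Shape-length []      = refl
  Shape-length (_ ∷ s) = cong suc (Shape-length s)

  Shape-nonEmpty : ∀ {J : Sentence k} {T : List (List Y)} → Shape J T → All NonEmpty J → All NonEmpty T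
  Shape-nonEmpty []                                 _       = []
  Shape-nonEmpty (_∷_ {w = []}    {t = t}     e s) (h ∷ a) = ⊥-elim (h refl)
  Shape-nonEmpty (_∷_ {w = _ ∷ _} {t = []}    () s) _
  Shape-nonEmpty (_∷_ {w = _ ∷ _} {t = _ ∷ _} e s) (h ∷ a) = (λ ()) ∷ Shape-nonEmpty s a

  Shape-addBox : ∀ {J : Sentence k} {T : List (List Y)} r c x → Shape J T → r ≤ length J →
                 Shape (addBox J r c) (addBox T r x)
  Shape-addBox                     zero    c x []      _       = refl ∷ []
  Shape-addBox {w ∷ J} {t ∷ T}     zero    c x (e ∷ s) _       =
    trans (ListP.length-++ t) (trans (cong (_+ 1) e) (sym (ListP.length-++ w))) ∷ s
  Shape-addBox                     (suc r) c x (e ∷ s) (s≤s h) = e ∷ Shape-addBox r c x s h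

  Shape-lengthʳ : ∀ {J : Sentence k} {T : List (List Y)} {r} → Shape J T → r ≤ length J → r ≤ length T
  Shape-lengthʳ s h = subst (_ ≤_) (sym (Shape-length s)) h

module _ {k M : ℕ} where

  All-allLists : ∀ l {R : List (Fin M) → Set} → (∀ ys → length ys ≡ l → R ys) → All R (allLists M l)
  All-allLists zero    f = f [] refl ∷ []
  All-allLists (suc l) {R} f = heads (allFin M)
    where
    heads : ∀ is → All R (concatMap (λ i → map (i ∷_) (allLists M l)) is)
    heads []       = []
    heads (i ∷ is) = AllP.++⁺ (AllP.map⁺ (All-allLists l (λ ys h → f (i ∷ ys) (cong suc h)))) (heads is)

  All-fillings : ∀ (J : Sentence k) {R : List (List (Fin M)) → Set} → (∀ T → Shape J T → R T) → All R (fillings M J)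
  All-fillings []      f = f [] [] ∷ []
  All-fillings (w ∷ J) {R} f = heads (allLists M (length w)) (All-allLists (length w) (λ _ h → h))
    where
    heads : ∀ ts → All (λ t → length t ≡ length w) ts → All R (concatMap (λ t → map (t ∷_) (fillings M J)) ts)
    heads []       _       = []
    heads (t ∷ ts) (h ∷ a) = AllP.++⁺ (AllP.map⁺ (All-fillings J (λ T s → f (t ∷ T) (h ∷ s)))) (heads ts a)

  ∑-fillings-cong : ∀ (J : Sentence k) {f g : List (List (Fin M)) → ℕ} → (∀ T → Shape J T → f T ≡ g T) →
                    ∑ (fillings M J) f ≡ ∑ (fillings M J) g
  ∑-fillings-cong J {f} {g} e = ∑-congᴬ (fillings M J) (All-fillings J {λ T → f T ≡ g T} e) (λ _ p → p)

  ∑-fillings-∷ : ∀ w (J : Sentence k) (f : List (List (Fin M)) → ℕ) →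
                 ∑ (fillings M (w ∷ J)) f ≡ ∑ (allLists M (length w)) (λ t → ∑ (fillings M J) (λ T → f (t ∷ T)))
  ∑-fillings-∷ w J f = trans (∑-concatMap (λ t → map (t ∷_) (fillings M J)) (allLists M (length w)) f)
                             (∑-cong (allLists M (length w)) (λ t → ∑-map (t ∷_) (fillings M J) f))

  ∑-allLists-∷ʳ : ∀ l (g : List (Fin M) → ℕ) →
                  ∑ (allLists M (suc l)) g ≡ ∑ (allLists M l) (λ ys → ∑ (allFin M) (λ x → g (ys ∷ʳ x)))
  ∑-allLists-∷ʳ zero    g =
    trans (∑-concatMap (λ i → map (i ∷_) ([] ∷ [])) (allFin M) g)
          (trans (∑-cong (allFin M) (λ i → ℕ.+-identityʳ (g (i ∷ [])))) (sym (ℕ.+-identityʳ _)))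
  ∑-allLists-∷ʳ (suc l) g = begin
    ∑ (allLists M (suc (suc l))) g
      ≡⟨ ∑-concatMap (λ i → map (i ∷_) (allLists M (suc l))) (allFin M) g ⟩
    ∑ (allFin M) (λ i → ∑ (map (i ∷_) (allLists M (suc l))) g)
      ≡⟨ ∑-cong (allFin M) (λ i → trans (∑-map (i ∷_) (allLists M (suc l)) g)
                                 (trans (∑-allLists-∷ʳ l (λ ys → g (i ∷ ys))) (sym (∑-map (i ∷_) (allLists M l) _)))) ⟩
    ∑ (allFin M) (λ i → ∑ (map (i ∷_) (allLists M l)) (λ ys → ∑ (allFin M) (λ x → g (ys ∷ʳ x))))
      ≡⟨ ∑-concatMap (λ i → map (i ∷_) (allLists M l)) (allFin M) _ ⟨
    ∑ (allLists M (suc l)) (λ ys → ∑ (allFin M) (λ x → g (ys ∷ʳ x))) ∎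
    where open ≡-Reasoning

  -- a filling of J is a filling of J without the box, together with the entry of the box
  ∑-fillings-removeBox : ∀ (J : Sentence k) r → IsSentence J → Removable J r → (f : List (List (Fin M)) → ℕ) →
                         ∑ (fillings M J) f ≡ ∑ (fillings M (removeBox J r)) (λ T′ → ∑ (allFin M) (λ x → f (addBox T′ r x)))
  ∑-fillings-removeBox (w ∷ J) (suc r) (nw ∷ ne) v f = begin
    ∑ (fillings M (w ∷ J)) f
      ≡⟨ ∑-fillings-∷ w J f ⟩
    ∑ (allLists M (length w)) (λ t → ∑ (fillings M J) (λ T → f (t ∷ T)))
      ≡⟨ ∑-cong (allLists M (length w)) (λ t → ∑-fillings-removeBox J r ne v (λ T → f (t ∷ T))) ⟩
    ∑ (allLists M (length w)) (λ t → ∑ (fillings M (removeBox J r)) (λ T′ → ∑ (allFin M) (λ x → f (t ∷ addBox T′ r x))))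
      ≡⟨ ∑-fillings-∷ w (removeBox J r) _ ⟨
    ∑ (fillings M (w ∷ removeBox J r)) (λ T′ → ∑ (allFin M) (λ x → f (addBox T′ (suc r) x))) ∎
    where open ≡-Reasoning
  ∑-fillings-removeBox (w ∷ J) zero (nw ∷ ne) v f with dropLast w | length-dropLast w nw
  ... | a ∷ as | |w|≡ = begin
    ∑ (fillings M (w ∷ J)) f
      ≡⟨ ∑-fillings-∷ w J f ⟩
    ∑ (allLists M (length w)) (λ t → ∑ (fillings M J) (λ T → f (t ∷ T)))
      ≡⟨ cong (λ l → ∑ (allLists M l) (λ t → ∑ (fillings M J) (λ T → f (t ∷ T)))) |w|≡ ⟩
    ∑ (allLists M (suc (length (a ∷ as)))) (λ t → ∑ (fillings M J) (λ T → f (t ∷ T)))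
      ≡⟨ ∑-allLists-∷ʳ (length (a ∷ as)) _ ⟩
    ∑ (allLists M (length (a ∷ as))) (λ ys → ∑ (allFin M) (λ x → ∑ (fillings M J) (λ T → f ((ys ∷ʳ x) ∷ T))))
      ≡⟨ ∑-cong (allLists M (length (a ∷ as))) (λ ys → ∑-swap (allFin M) (fillings M J) (λ x T → f ((ys ∷ʳ x) ∷ T))) ⟩
    ∑ (allLists M (length (a ∷ as))) (λ ys → ∑ (fillings M J) (λ T → ∑ (allFin M) (λ x → f ((ys ∷ʳ x) ∷ T))))
      ≡⟨ ∑-fillings-∷ (a ∷ as) J _ ⟨
    ∑ (fillings M ((a ∷ as) ∷ J)) (λ T′ → ∑ (allFin M) (λ x → f (addBox T′ zero x))) ∎
    where open ≡-Reasoning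
  ... | []     | |w|≡1 with v
  ...   | inj₁ 2≤|w|        with () ← ℕ.<-irrefl refl (ℕ.≤-trans 2≤|w| (ℕ.≤-reflexive |w|≡1))
  ...   | inj₂ (_ , refl) = begin
    ∑ (fillings M (w ∷ [])) f
      ≡⟨ ∑-fillings-∷ w [] f ⟩
    ∑ (allLists M (length w)) (λ t → f (t ∷ []) + 0)
      ≡⟨ cong (λ l → ∑ (allLists M l) (λ t → f (t ∷ []) + 0)) |w|≡1 ⟩
    ∑ (allLists M 1) (λ t → f (t ∷ []) + 0)
      ≡⟨ ∑-allLists-∷ʳ 0 _ ⟩
    ∑ (allFin M) (λ x → f ((x ∷ []) ∷ []) + 0) + 0
      ≡⟨ cong (_+ 0) (∑-cong (allFin M) (λ x → ℕ.+-identityʳ (f ((x ∷ []) ∷ [])))) ⟩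
    ∑ (allFin M) (λ x → f ((x ∷ []) ∷ [])) + 0 ∎
    where open ≡-Reasoning

module _ {M : ℕ} where

  All-firstColumn : ∀ {P : Fin M → Set} (T : List (List (Fin M))) → All P (concat T) → All P (firstColumn T)
  All-firstColumn []            a        = []
  All-firstColumn ([] ∷ T)      a        = All-firstColumn T a
  All-firstColumn ((e ∷ t) ∷ T) (pe ∷ a) = pe ∷ All-firstColumn T (AllP.++⁻ʳ t a)

  firstColumn-addBox : ∀ (T : List (List (Fin M))) r x → All NonEmpty T → r ≤ length T →
                       firstColumn (addBox T r x) ≡ firstColumn T ⊎
                       (firstColumn (addBox T r x) ≡ firstColumn T ∷ʳ x × r ≡ length T)
  firstColumn-addBox []            zero    x _        _       = inj₂ (refl , refl)
  firstColumn-addBox ([] ∷ T)      _       x (h ∷ _)  _       = ⊥-elim (h refl)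
  firstColumn-addBox ((e ∷ t) ∷ T) zero    x _        _       = inj₁ refl
  firstColumn-addBox ((e ∷ t) ∷ T) (suc r) x (_ ∷ ne) (s≤s h) with firstColumn-addBox T r x ne h
  ... | inj₁ eq       = inj₁ (cong (e ∷_) eq)
  ... | inj₂ (eq , q) = inj₂ (cong (e ∷_) eq , cong suc q)

  All-addBox⁻ : ∀ {P : List (Fin M) → Set} (T : List (List (Fin M))) r x → r ≤ length T →
                (∀ t → P (t ∷ʳ x) → P t) → All P (addBox T r x) → All P T
  All-addBox⁻ []      zero    x _       f _        = []
  All-addBox⁻ (t ∷ T) zero    x _       f (p ∷ ps) = f t p ∷ ps
  All-addBox⁻ (t ∷ T) (suc r) x (s≤s h) f (p ∷ ps) = p ∷ All-addBox⁻ T r x h f ps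

  rows-addBox⁺ : ∀ (T : List (List (Fin M))) r x → r ≤ length T → All (Linked F._≤_) T →
                 All (F._≤ x) (concat T) → All (Linked F._≤_) (addBox T r x)
  rows-addBox⁺ []      zero    x _       _        _ = [-] ∷ []
  rows-addBox⁺ (t ∷ T) zero    x _       (l ∷ ls) a = Linked-∷ʳ⁺ t x l (AllP.++⁻ˡ t a) ∷ ls
  rows-addBox⁺ (t ∷ T) (suc r) x (s≤s h) (l ∷ ls) a = l ∷ rows-addBox⁺ T r x h ls (AllP.++⁻ʳ t a)

  isCIT-addBox⁻ : ∀ (T : List (List (Fin M))) r x → All NonEmpty T → r ≤ length T → IsCIT (addBox T r x) → IsCIT T
  isCIT-addBox⁻ T r x ne h (rows , col) =
    All-addBox⁻ T r x h (λ t → Linked-++⁻ˡ t) rows , column (firstColumn-addBox T r x ne h)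
    where
    column : _ → Linked F._<_ (firstColumn T)
    column (inj₁ eq)      = subst (Linked F._<_) eq col
    column (inj₂ (eq , _)) = Linked-++⁻ˡ (firstColumn T) (subst (Linked F._<_) eq col)

  isCIT-addBox⁺ : ∀ (T : List (List (Fin M))) r x → All NonEmpty T → r ≤ length T → IsCIT T →
                  All (F._≤ x) (concat T) → (r ≡ length T → All (F._< x) (concat T)) → IsCIT (addBox T r x)
  isCIT-addBox⁺ T r x ne h (rows , col) ≤x <x with firstColumn-addBox T r x ne h
  ... | inj₁ eq        = rows-addBox⁺ T r x h rows ≤x , subst (Linked F._<_) (sym eq) col
  ... | inj₂ (eq , r≡) =
    rows-addBox⁺ T r x h rows ≤x , subst (Linked F._<_) (sym eq) (Linked-∷ʳ⁺ (firstColumn T) x col (All-firstColumn T (<x r≡)))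

  row-maximum : ∀ (T : List (List (Fin M))) r x → r ≤ length T → All (Linked F._≤_) (addBox T r x) →
                All (F._≤ x) (rowAt T r ∷ʳ x)
  row-maximum T r x h rows =
    Linked-∷ʳ⇒≤last FinP.≤-trans FinP.≤-refl (rowAt T r) x
      (subst (Linked F._≤_) (rowAt-addBox T r x h) (All-rowAt (addBox T r x) r rows []))

  maximum-in-removable-row : ∀ {k} (J : Sentence k) (T : List (List (Fin M))) r a → IsSentence J → Shape J T →
                             r < length J → ¬ Removable J r → IsCIT T → Any (_≡ a) (rowAt T r) →
                             All (F._≤ a) (concat T) → ⊥
  maximum-in-removable-row (w ∷ J) (t ∷ T) zero a (nw ∷ ne) (e ∷ s) _ ¬v (_ , col) a∈t ≤a = inFirstRow w t J T nw ne e s ¬v col a∈t ≤a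
    where
    -- a is alone in its row, so the first entry of the next row would have to exceed it
    inFirstRow : ∀ w t J T → NonEmpty w → IsSentence J → length t ≡ length w → Shape J T → ¬ Removable (w ∷ J) zero →
         Linked F._<_ (firstColumn (t ∷ T)) → Any (_≡ a) t → All (F._≤ a) (concat (t ∷ T)) → ⊥
    inFirstRow []           _        _        _              nw _          _ _        _  _        _          _ = nw refl
    inFirstRow (_ ∷ _ ∷ _)  _        _        _              _  _          _ _        ¬v _        _          _ = ¬v (inj₁ (s≤s (s≤s z≤n)))
    inFirstRow (_ ∷ [])     _        []       _              _  _          _ _        ¬v _        _          _ = ¬v (inj₂ (refl , refl))
    inFirstRow (_ ∷ [])     (_ ∷ []) (w₂ ∷ J) ([] ∷ T)       _  (nw₂ ∷ _) _ (e₂ ∷ _)  _  _        _          _ =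
      All.head (Shape-nonEmpty {Y = Fin M} (e₂ ∷ []) (nw₂ ∷ [])) refl
    inFirstRow (_ ∷ [])     (_ ∷ []) (w₂ ∷ J) ((f ∷ _) ∷ T) _  _          _ (_ ∷ _)   _  (lt ∷ _) (here refl) (_ ∷ f≤a ∷ _) =
      ℕ.<-irrefl refl (ℕ.<-≤-trans lt f≤a)
  maximum-in-removable-row (w ∷ J) (t ∷ T) (suc r) a (nw ∷ ne) (e ∷ s) (s≤s h) ¬v (rows , col) a∈r ≤a =
    maximum-in-removable-row J T r a ne s h ¬v (All.tail rows , tailColumn t (All.head (Shape-nonEmpty (e ∷ s) (nw ∷ ne))) col)
      a∈r (AllP.++⁻ʳ t ≤a)
    where
    tailColumn : ∀ t → NonEmpty t → Linked F._<_ (firstColumn (t ∷ T)) → Linked F._<_ (firstColumn T)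
    tailColumn []      h _ = ⊥-elim (h refl)
    tailColumn (y ∷ t) h l with firstColumn T | l
    ... | []     | _      = []
    ... | z ∷ zs | _ ∷ l′ = l′

lookup-ext : ∀ {A : Set} {n} (u v : Vec A n) → (∀ j → lookup u j ≡ lookup v j) → u ≡ v
lookup-ext u v e = trans (sym (VecP.tabulate∘lookup u)) (trans (VecP.tabulate-cong e) (VecP.tabulate∘lookup v))

All-reverse : ∀ {A : Set} {P : A → Set} (xs : List A) → All P xs → All P (reverse xs)
All-reverse []       a       = []
All-reverse (x ∷ xs) (p ∷ a) rewrite ListP.unfold-reverse x xs = AllP.++⁺ (All-reverse xs a) (p ∷ [])

All-reverse⁻ : ∀ {A : Set} {P : A → Set} (xs : List A) → All P (reverse xs) → All P xs
All-reverse⁻ []       a = []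
All-reverse⁻ (x ∷ xs) a rewrite ListP.unfold-reverse x xs with AllP.++⁻ (reverse xs) a
... | a₁ , (p ∷ []) = p ∷ All-reverse⁻ xs a₁

concat≡[]⁻ : ∀ {A : Set} (L : List (List A)) → concat L ≡ [] → All (_≡ []) L
concat≡[]⁻ []            e  = []
concat≡[]⁻ ([] ∷ L)      e  = refl ∷ concat≡[]⁻ L e
concat≡[]⁻ ((x ∷ l) ∷ L) ()

concat≡[] : ∀ {A : Set} (L : List (List A)) → All (_≡ []) L → concat L ≡ []
concat≡[] []       a           = refl
concat≡[] ([] ∷ L) (_ ∷ a) = concat≡[] L a

zip-∷ʳ : ∀ {A B : Set} (w : List A) (t : List B) c x → length t ≡ length w → zip (w ∷ʳ c) (t ∷ʳ x) ≡ zip w t ∷ʳ (c , x)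
zip-∷ʳ []      []      c x _ = refl
zip-∷ʳ (a ∷ w) (b ∷ t) c x h = cong ((a , b) ∷_) (zip-∷ʳ w t c x (ℕ.suc-injective h))

module _ {k m : ℕ} where

  colorsAt : Fin m → List (Word k × List (Fin m)) → Word k
  colorsAt j Z = concat (map (rowColorsOf j) (reverse Z))

  lookup-monoT : ∀ (J : Sentence k) (T : List (List (Fin m))) j → lookup (monoT J T) j ≡ colorsAt j (zip J T)
  lookup-monoT J T j = VecP.lookup∘tabulate _ j

  rowColorsOf≡[]⇒∉ : ∀ (j : Fin m) (w : Word k) t → length t ≡ length w → rowColorsOf j (w , t) ≡ [] → ¬ Any (_≡ j) t
  rowColorsOf≡[]⇒∉ j (c ∷ w) (e ∷ t) h r a with e ≟ᶠ j | a
  rowColorsOf≡[]⇒∉ j (c ∷ w) (e ∷ t) h () a | yes _ | _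
  ... | no e≢j | here q   = e≢j q
  ... | no _   | there a′ = rowColorsOf≡[]⇒∉ j w t (ℕ.suc-injective h) r a′

  ∉⇒rowColorsOf≡[] : ∀ (j : Fin m) (w : Word k) t → ¬ Any (_≡ j) t → rowColorsOf j (w , t) ≡ []
  ∉⇒rowColorsOf≡[] j []      t       _  = refl
  ∉⇒rowColorsOf≡[] j (c ∷ w) []      _  = refl
  ∉⇒rowColorsOf≡[] j (c ∷ w) (e ∷ t) na with e ≟ᶠ j
  ... | yes q = ⊥-elim (na (here q))
  ... | no _  = ∉⇒rowColorsOf≡[] j w t (λ a → na (there a))

  ∈⇒monoT≢[] : ∀ {J : Sentence k} {T : List (List (Fin m))} j → Shape J T → Any (_≡ j) (concat T) →
               lookup (monoT J T) j ≢ []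
  ∈⇒monoT≢[] {J} {T} j s a e =
    noColor s (All-reverse⁻ (zip J T) (AllP.map⁻ (concat≡[]⁻ _ (trans (sym (lookup-monoT J T j)) e)))) a
    where
    noColor : ∀ {J T} → Shape J T → All (λ p → rowColorsOf j p ≡ []) (zip J T) → Any (_≡ j) (concat T) → ⊥
    noColor {w ∷ J} {t ∷ T} (h ∷ s) (r ∷ rs) a with AnyP.++⁻ t a
    ... | inj₁ b = rowColorsOf≡[]⇒∉ j w t h r b
    ... | inj₂ b = noColor s rs b

  ∉⇒monoT≡[] : ∀ (J : Sentence k) (T : List (List (Fin m))) j → ¬ Any (_≡ j) (concat T) →
               lookup (monoT J T) j ≡ []
  ∉⇒monoT≡[] J T j na =
    trans (lookup-monoT J T j) (concat≡[] _ (AllP.map⁺ (All-reverse (zip J T) (noColors J T na))))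
    where
    noColors : ∀ J T → ¬ Any (_≡ j) (concat T) → All (λ p → rowColorsOf j p ≡ []) (zip J T)
    noColors []      T       _  = []
    noColors (w ∷ J) []      _  = []
    noColors (w ∷ J) (t ∷ T) na = ∉⇒rowColorsOf≡[] j w t (λ a → na (AnyP.++⁺ˡ a)) ∷ noColors J T (λ a → na (AnyP.++⁺ʳ t a))

  rowColorsOf-∷ʳ : ∀ (j : Fin m) (w : Word k) t c x → length t ≡ length w →
                   rowColorsOf j (w ∷ʳ c , t ∷ʳ x) ≡ rowColorsOf j (w , t) ++ rowColorsOf j (c ∷ [] , x ∷ [])
  rowColorsOf-∷ʳ j w t c x h
    rewrite zip-∷ʳ w t c x h | ListP.filter-++ (λ p → proj₂ p ≟ᶠ j) (zip w t) ((c , x) ∷ []) =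
    ListP.map-++ proj₁ (filter (λ p → proj₂ p ≟ᶠ j) (zip w t)) _

  colorsAt-∷ : ∀ j p Z → colorsAt j (p ∷ Z) ≡ colorsAt j Z ++ rowColorsOf j p
  colorsAt-∷ j p Z rewrite ListP.unfold-reverse p Z | ListP.map-++ (rowColorsOf j) (reverse Z) (p ∷ []) =
    trans (sym (ListP.concat-++ (map (rowColorsOf j) (reverse Z)) (rowColorsOf j p ∷ [])))
          (cong (colorsAt j Z ++_) (ListP.++-identityʳ (rowColorsOf j p)))

  -- the new box is read last because x does not occur in the rows above it
  colorsAt-addBox : ∀ (J : Sentence k) (T : List (List (Fin m))) r c x j → Shape J T → r ≤ length J →
                    All (λ t → ¬ Any (_≡ x) t) (take r T) →
                    colorsAt j (zip (addBox J r c) (addBox T r x)) ≡ colorsAt j (zip J T) ++ rowColorsOf j (c ∷ [] , x ∷ [])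
  colorsAt-addBox []      []      zero    c x j []      _       _        = ListP.++-identityʳ _
  colorsAt-addBox (w ∷ J) (t ∷ T) zero    c x j (h ∷ s) _       _        = begin
    colorsAt j ((w ∷ʳ c , t ∷ʳ x) ∷ zip J T)
      ≡⟨ colorsAt-∷ j _ (zip J T) ⟩
    colorsAt j (zip J T) ++ rowColorsOf j (w ∷ʳ c , t ∷ʳ x)
      ≡⟨ cong (colorsAt j (zip J T) ++_) (rowColorsOf-∷ʳ j w t c x h) ⟩
    colorsAt j (zip J T) ++ rowColorsOf j (w , t) ++ new
      ≡⟨ ListP.++-assoc (colorsAt j (zip J T)) (rowColorsOf j (w , t)) new ⟨
    (colorsAt j (zip J T) ++ rowColorsOf j (w , t)) ++ new
      ≡⟨ cong (_++ new) (colorsAt-∷ j (w , t) (zip J T)) ⟨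
    colorsAt j ((w , t) ∷ zip J T) ++ new
      ∎
    where
    open ≡-Reasoning
    new = rowColorsOf j (c ∷ [] , x ∷ [])
  colorsAt-addBox (w ∷ J) (t ∷ T) (suc r) c x j (h ∷ s) (s≤s hr) (x∉t ∷ a) = begin
    colorsAt j ((w , t) ∷ zip (addBox J r c) (addBox T r x))
      ≡⟨ colorsAt-∷ j (w , t) (zip (addBox J r c) (addBox T r x)) ⟩
    colorsAt j (zip (addBox J r c) (addBox T r x)) ++ old
      ≡⟨ cong (_++ old) (colorsAt-addBox J T r c x j s hr a) ⟩
    (colorsAt j (zip J T) ++ new) ++ old
      ≡⟨ ListP.++-assoc (colorsAt j (zip J T)) new old ⟩
    colorsAt j (zip J T) ++ new ++ old
      ≡⟨ cong (colorsAt j (zip J T) ++_) commute ⟩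
    colorsAt j (zip J T) ++ old ++ new
      ≡⟨ ListP.++-assoc (colorsAt j (zip J T)) old new ⟨
    (colorsAt j (zip J T) ++ old) ++ new
      ≡⟨ cong (_++ new) (colorsAt-∷ j (w , t) (zip J T)) ⟨
    colorsAt j ((w , t) ∷ zip J T) ++ new
      ∎
    where
    open ≡-Reasoning
    old = rowColorsOf j (w , t)
    new = rowColorsOf j (c ∷ [] , x ∷ [])
    commute : rowColorsOf j (c ∷ [] , x ∷ []) ++ rowColorsOf j (w , t) ≡ rowColorsOf j (w , t) ++ rowColorsOf j (c ∷ [] , x ∷ [])
    commute with x ≟ᶠ j
    ... | yes refl = trans (cong (c ∷_) x∉row) (cong (_++ c ∷ []) (sym x∉row))
      where x∉row = ∉⇒rowColorsOf≡[] x w t x∉t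
    ... | no _     = sym (ListP.++-identityʳ _)

  monoT-addBox : ∀ (J : Sentence k) (T : List (List (Fin m))) r c x → Shape J T → r ≤ length J →
                 All (λ t → ¬ Any (_≡ x) t) (take r T) → ∀ j →
                 lookup (monoT (addBox J r c) (addBox T r x)) j ≡ lookup (monoT J T) j ++ rowColorsOf j (c ∷ [] , x ∷ [])
  monoT-addBox J T r c x s h x∉ j =
    trans (lookup-monoT (addBox J r c) (addBox T r x) j)
          (trans (colorsAt-addBox J T r c x j s h x∉) (cong (_++ _) (sym (lookup-monoT J T j))))

  rowColorsOf-single-≡ : ∀ (c : Fin k) (x : Fin m) → rowColorsOf x (c ∷ [] , x ∷ []) ≡ c ∷ []
  rowColorsOf-single-≡ c x with x ≟ᶠ x
  ... | yes _  = refl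
  ... | no x≢x = ⊥-elim (x≢x refl)

  rowColorsOf-single-≢ : ∀ (c : Fin k) (x j : Fin m) → x ≢ j → rowColorsOf j (c ∷ [] , x ∷ []) ≡ []
  rowColorsOf-single-≢ c x j x≢j with x ≟ᶠ j
  ... | yes e = ⊥-elim (x≢j e)
  ... | no _  = refl

monoFlags : ∀ {k m} → Mono k m → List (Flag k)
monoFlags []      = []
monoFlags (w ∷ u) = wordFlags true w ++ monoFlags u

monoFlags≡flags : ∀ {k m} (u : Mono k m) → monoFlags u ≡ flags (nonemptyWords u)
monoFlags≡flags []            = refl
monoFlags≡flags ([] ∷ u)      = monoFlags≡flags u
monoFlags≡flags ((c ∷ w) ∷ u) = cong (wordFlags true (c ∷ w) ++_) (monoFlags≡flags u)

monoFlags-oneM : ∀ {k m} → monoFlags (oneM {k} {m}) ≡ []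
monoFlags-oneM {m = zero}  = refl
monoFlags-oneM {m = suc m} = monoFlags-oneM {m = m}

monoFlags≡[] : ∀ {k m} (u : Mono k m) → monoFlags u ≡ [] → u ≡ oneM
monoFlags≡[] []            _ = refl
monoFlags≡[] ([] ∷ u)      e = cong ([] ∷_) (monoFlags≡[] u e)
monoFlags≡[] ((c ∷ w) ∷ u) ()

lookup-oneM : ∀ {k m} (j : Fin m) → lookup (oneM {k} {m}) j ≡ []
lookup-oneM fzero    = refl
lookup-oneM (fsuc j) = lookup-oneM j

wordFlags-∷ʳ : ∀ {k} (w : Word k) c → wordFlags true (w ∷ʳ c) ≡ wordFlags true w ∷ʳ (c , null w)
wordFlags-∷ʳ []      c = refl
wordFlags-∷ʳ (a ∷ w) c = cong ((a , true) ∷_) (inner w)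
  where
  inner : ∀ w → wordFlags false (w ∷ʳ c) ≡ wordFlags false w ∷ʳ (c , false)
  inner []      = refl
  inner (b ∷ w) = cong ((b , false) ∷_) (inner w)

∷ʳ≢[] : ∀ {A : Set} (xs : List A) {x} → xs ∷ʳ x ≢ []
∷ʳ≢[] []      ()
∷ʳ≢[] (_ ∷ _) ()

-- u = u⁻ · x_{c,i}, where i is the largest index with a nonempty word
record LastLetter {k m : ℕ} (u : Mono k m) : Set where
  field
    i          : Fin m
    u⁻         : Mono k m
    w          : Word k
    c          : Fin k
    lookup-i   : lookup u i ≡ w ∷ʳ c
    lookup-≢i  : ∀ j → j ≢ i → lookup u j ≡ lookup u⁻ j
    lookup⁻-i  : lookup u⁻ i ≡ w
    lookup->i  : ∀ j → i F.< j → lookup u j ≡ []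
    monoFlags≡ : monoFlags u ≡ monoFlags u⁻ ∷ʳ (c , null w)

lastLetter : ∀ {k m} (u : Mono k m) → (u ≡ oneM) ⊎ LastLetter u
lastLetter []              = inj₁ refl
lastLetter {k} {suc m} (w₀ ∷ u) with lastLetter u
... | inj₂ d = inj₂ record
  { i          = fsuc i
  ; u⁻         = w₀ ∷ u⁻
  ; w          = w
  ; c          = c
  ; lookup-i   = lookup-i
  ; lookup-≢i  = λ { fzero _ → refl ; (fsuc j) j≢i → lookup-≢i j (λ e → j≢i (cong fsuc e)) }
  ; lookup⁻-i  = lookup⁻-i
  ; lookup->i  = λ { fzero () ; (fsuc j) (s≤s lt) → lookup->i j lt }
  ; monoFlags≡ = trans (cong (wordFlags true w₀ ++_) monoFlags≡) (sym (ListP.++-assoc (wordFlags true w₀) (monoFlags u⁻) _))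
  }
  where open LastLetter d
... | inj₁ refl with w₀
...   | []     = inj₁ refl
...   | a ∷ w′ with last-nonEmpty (a ∷ w′) (λ ())
...     | c , lc = inj₂ record
  { i          = fzero
  ; u⁻         = v ∷ oneM
  ; w          = v
  ; c          = c
  ; lookup-i   = dropLast-last (a ∷ w′) c lc
  ; lookup-≢i  = λ { fzero 0≢0 → ⊥-elim (0≢0 refl) ; (fsuc j) _ → refl }
  ; lookup⁻-i  = refl
  ; lookup->i  = λ { fzero () ; (fsuc j) _ → lookup-oneM j }
  ; monoFlags≡ = begin
      wordFlags true (a ∷ w′) ++ monoFlags (oneM {k} {m})
        ≡⟨ cong₂ _++_ (cong (wordFlags true) (dropLast-last (a ∷ w′) c lc)) (monoFlags-oneM {k} {m}) ⟩
      wordFlags true (v ∷ʳ c) ++ []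
        ≡⟨ ListP.++-identityʳ _ ⟩
      wordFlags true (v ∷ʳ c)
        ≡⟨ wordFlags-∷ʳ v c ⟩
      wordFlags true v ∷ʳ (c , null v)
        ≡⟨ cong (_∷ʳ (c , null v)) (trans (cong (wordFlags true v ++_) (monoFlags-oneM {k} {m})) (ListP.++-identityʳ _)) ⟨
      (wordFlags true v ++ monoFlags (oneM {k} {m})) ∷ʳ (c , null v) ∎
  }
  where
  open ≡-Reasoning
  v = dropLast (a ∷ w′)

-- Splitting a count according to the topmost row containing a marked entry

All-lookup≡ : ∀ {A : Set} {P : A → Set} {xs : List A} {y} → All P xs → Any (_≡ y) xs → P y
All-lookup≡ (p ∷ _) (here refl) = p
All-lookup≡ (_ ∷ a) (there q)   = All-lookup≡ a q

All-tabulate≡ : ∀ {A : Set} {P : A → Set} (xs : List A) → (∀ y → Any (_≡ y) xs → P y) → All P xs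
All-tabulate≡ []       f = []
All-tabulate≡ (x ∷ xs) f = f x (here refl) ∷ All-tabulate≡ xs (λ y a → f y (there a))

All-upTo : ∀ n → All (_< n) (upTo n)
All-upTo n = AllP.applyUpTo⁺₁ (λ l → l) n (λ lt → lt)

∑-applyUpTo-suc : ∀ n (g : ℕ → ℕ) → ∑ (applyUpTo suc n) g ≡ ∑ (upTo n) (λ r → g (suc r))
∑-applyUpTo-suc n g = trans (cong (λ z → ∑ z g) (sym (ListP.map-upTo suc n))) (∑-map suc (upTo n) g)

module TopmostRow {X : Set} {Q : X → Set} (Q? : Decidable Q) where

  AbsentAbove : ℕ → List (List X) → Set
  AbsentAbove ρ T = All (λ t → ¬ Any Q t) (take ρ T)

  absentAbove? : ∀ ρ T → Dec (AbsentAbove ρ T)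
  absentAbove? ρ T = all? (λ t → ¬? (any? Q? t)) (take ρ T)

  TopmostIn : ℕ → List (List X) → Set
  TopmostIn r T = Any Q (rowAt T r) × AbsentAbove r T

  topmostIn? : ∀ r T → Dec (TopmostIn r T)
  topmostIn? r T = any? Q? (rowAt T r) ×-dec absentAbove? r T

  absentAbove⇒∉row : ∀ ρ (T : List (List X)) r → AbsentAbove ρ T → r < ρ → ¬ Any Q (rowAt T r)
  absentAbove⇒∉row (suc ρ) (t ∷ T) zero    (h ∷ _) _        = h
  absentAbove⇒∉row (suc ρ) (t ∷ T) (suc r) (_ ∷ a) (s≤s lt) = absentAbove⇒∉row ρ T r a lt
  absentAbove⇒∉row (suc ρ) []      r       _       _        ()

  absentAbove-mono : ∀ ρ r (T : List (List X)) → ρ ≤ r → AbsentAbove r T → AbsentAbove ρ T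
  absentAbove-mono ρ r T ρ≤r a =
    subst (All _) (trans (ListP.take-take ρ r T) (cong (λ n → take n T) (ℕ.m≤n⇒m⊓n≡m ρ≤r))) (AllP.take⁺ ρ a)

  ∉⇒absentAbove : ∀ ρ (T : List (List X)) → ¬ Any Q (concat T) → AbsentAbove ρ T
  ∉⇒absentAbove ρ T na = AllP.take⁺ ρ (rows T na)
    where
    rows : ∀ T → ¬ Any Q (concat T) → All (λ t → ¬ Any Q t) T
    rows []      _  = []
    rows (t ∷ T) na = (λ a → na (AnyP.++⁺ˡ a)) ∷ rows T (λ a → na (AnyP.++⁺ʳ t a))

  absentAbove-all : ∀ (T : List (List X)) → AbsentAbove (length T) T → All (λ e → ¬ Q e) (concat T)
  absentAbove-all T a = entries T (subst (All _) (ListP.take-all (length T) T ℕ.≤-refl) a)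
    where
    entries : ∀ T → All (λ t → ¬ Any Q t) T → All (λ e → ¬ Q e) (concat T)
    entries []      _       = []
    entries (t ∷ T) (h ∷ a) = AllP.++⁺ (All.tabulate (λ y∈t q → h (Any.map (λ { refl → q }) y∈t))) (entries T a)

  ∑-topmostIn≡1 : ∀ T → Any Q (concat T) → ∑ (upTo (length T)) (λ r → 𝟙 (topmostIn? r T)) ≡ 1
  ∑-topmostIn≡1 (t ∷ T) a with any? Q? t
  ... | yes q = cong suc (begin
    ∑ (applyUpTo suc (length T)) (λ r → 𝟙 (topmostIn? r (t ∷ T)))
      ≡⟨ ∑-applyUpTo-suc (length T) _ ⟩
    ∑ (upTo (length T)) (λ r → 𝟙 (topmostIn? (suc r) (t ∷ T)))
      ≡⟨ ∑-cong (upTo (length T)) (λ r → 𝟙-no (topmostIn? (suc r) (t ∷ T)) (λ { (_ , (h ∷ _)) → h q })) ⟩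
    ∑ (upTo (length T)) (λ _ → 0)
      ≡⟨ ∑-zero (upTo (length T)) ⟩
    0 ∎)
    where open ≡-Reasoning
  ... | no ¬q = begin
    ∑ (applyUpTo suc (length T)) (λ r → 𝟙 (topmostIn? r (t ∷ T)))
      ≡⟨ ∑-applyUpTo-suc (length T) _ ⟩
    ∑ (upTo (length T)) (λ r → 𝟙 (topmostIn? (suc r) (t ∷ T)))
      ≡⟨ ∑-cong (upTo (length T)) (λ r → 𝟙-cong (topmostIn? (suc r) (t ∷ T)) (topmostIn? r T)
                                              (λ { (x , (_ ∷ y)) → x , y }) (λ { (x , y) → x , (¬q ∷ y) })) ⟩
    ∑ (upTo (length T)) (λ r → 𝟙 (topmostIn? r T))
      ≡⟨ ∑-topmostIn≡1 T (inTail (AnyP.++⁻ t a)) ⟩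
    1 ∎
    where
    open ≡-Reasoning
    inTail : Any Q t ⊎ Any Q (concat T) → Any Q (concat T)
    inTail (inj₁ q) = ⊥-elim (¬q q)
    inTail (inj₂ q) = q

  ∑-by-topmostRow : ∀ (Ts : List (List (List X))) L {P : List (List X) → Set} (P? : Decidable P) →
                    All (λ T → P T → Any Q (concat T) × length T ≡ L) Ts →
                    ∑ Ts (λ T → 𝟙 (P? T)) ≡ ∑ (upTo L) (λ r → ∑ Ts (λ T → 𝟙 (P? T) * 𝟙 (topmostIn? r T)))
  ∑-by-topmostRow Ts L {P} P? a =
    trans (∑-congᴬ Ts a split) (∑-swap Ts (upTo L) (λ T r → 𝟙 (P? T) * 𝟙 (topmostIn? r T)))
    where
    split : ∀ T → (P T → Any Q (concat T) × length T ≡ L) →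
            𝟙 (P? T) ≡ ∑ (upTo L) (λ r → 𝟙 (P? T) * 𝟙 (topmostIn? r T))
    split T h with P? T
    ... | no _  = sym (∑-zero (upTo L))
    ... | yes p with h p
    ...   | q , refl = sym (trans (∑-cong (upTo (length T)) (λ r → ℕ.+-identityʳ _)) (∑-topmostIn≡1 T q))

EndsWith : ∀ {k} → Sentence k → ℕ → Fin k → Set
EndsWith J r c = Removable J r × last (rowAt J r) ≡ just c

endsWith? : ∀ {k} (J : Sentence k) r c → Dec (EndsWith J r c)
endsWith? J r c = removable? J r ×-dec MaybeP.≡-dec _≟ᶠ_ (last (rowAt J r)) (just c)

-- A count of fillings whose marked entry is forced into the last box of its topmost row
-- becomes, row by row, a count of fillings of the diagram with that box removed.
module RemovedBox {k M : ℕ} {Q : Fin M → Set} (Q? : Decidable Q) (J : Sentence k) (pJ : IsSentence J)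
                  {P : List (List (Fin M)) → Set} (P? : Decidable P) (ρ : ℕ) (c : Fin k) (x₀ : Fin M)
                  {P′ : ℕ → List (List (Fin M)) → Set} (P′? : ∀ r → Decidable (P′ r)) where
  open TopmostRow Q?

  record Conditions : Set where
    field
      marked       : ∀ T → Shape J T → P T → Any Q (concat T)
      notRemovable : ∀ r T → Shape J T → r < length J → ¬ Removable J r → P T → TopmostIn r T → ⊥
      remove       : ∀ r T′ x → Removable J r → Shape (removeBox J r) T′ → P (addBox T′ r x) → TopmostIn r (addBox T′ r x) →
                     x ≡ x₀ × ρ ≤ r × last (rowAt J r) ≡ just c × P′ r T′
      add          : ∀ r T′ → Removable J r → Shape (removeBox J r) T′ → ρ ≤ r → last (rowAt J r) ≡ just c → P′ r T′ →
                     P (addBox T′ r x₀) × TopmostIn r (addBox T′ r x₀)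

  module _ (conditions : Conditions) where
    open Conditions conditions

    ends? : ∀ r → Dec (last (rowAt J r) ≡ just c)
    ends? r = MaybeP.≡-dec _≟ᶠ_ (last (rowAt J r)) (just c)

    𝟙-addBox : ∀ r → Removable J r → ∀ T′ → Shape (removeBox J r) T′ → ∀ x →
               𝟙 (P? (addBox T′ r x)) * 𝟙 (topmostIn? r (addBox T′ r x)) ≡
               𝟙 (x ≟ᶠ x₀) * (𝟙 (ρ ≤? r) * (𝟙 (ends? r) * 𝟙 (P′? r T′)))
    𝟙-addBox r v T′ s x with x ≟ᶠ x₀
    ... | no x≢x₀  = trans (sym (𝟙-× (P? _) (topmostIn? r _)))
                           (𝟙-no (P? _ ×-dec topmostIn? r _) (λ (p , t) → x≢x₀ (proj₁ (remove r T′ x v s p t))))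
    ... | yes refl = begin
      𝟙 (P? (addBox T′ r x)) * 𝟙 (topmostIn? r (addBox T′ r x))
        ≡⟨ 𝟙-× (P? _) (topmostIn? r _) ⟨
      𝟙 (P? (addBox T′ r x) ×-dec topmostIn? r (addBox T′ r x))
        ≡⟨ 𝟙-cong (P? _ ×-dec topmostIn? r _) ((ρ ≤? r) ×-dec ends? r ×-dec P′? r T′)
                  (λ (p , t) → proj₂ (remove r T′ x v s p t)) (λ (ρ≤r , e , p′) → add r T′ v s ρ≤r e p′) ⟩
      𝟙 ((ρ ≤? r) ×-dec ends? r ×-dec P′? r T′)
        ≡⟨ trans (𝟙-× (ρ ≤? r) (ends? r ×-dec P′? r T′)) (cong (𝟙 (ρ ≤? r) *_) (𝟙-× (ends? r) (P′? r T′))) ⟩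
      𝟙 (ρ ≤? r) * (𝟙 (ends? r) * 𝟙 (P′? r T′))
        ≡⟨ ℕ.+-identityʳ _ ⟨
      1 * (𝟙 (ρ ≤? r) * (𝟙 (ends? r) * 𝟙 (P′? r T′))) ∎
      where open ≡-Reasoning

    ∑-topmostIn-row : ∀ r → r < length J → Dec (Removable J r) →
                      ∑ (fillings M J) (λ T → 𝟙 (P? T) * 𝟙 (topmostIn? r T)) ≡
                      𝟙 (ρ ≤? r) * (𝟙 (endsWith? J r c) * ∑ (fillings M (removeBox J r)) (λ T′ → 𝟙 (P′? r T′)))
    ∑-topmostIn-row r r<J (no ¬v) = begin
      ∑ (fillings M J) (λ T → 𝟙 (P? T) * 𝟙 (topmostIn? r T))
        ≡⟨ ∑-fillings-cong J (λ T s → trans (sym (𝟙-× (P? T) (topmostIn? r T)))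
                                     (𝟙-no (P? T ×-dec topmostIn? r T) (λ (p , t) → notRemovable r T s r<J ¬v p t))) ⟩
      ∑ (fillings M J) (λ _ → 0)
        ≡⟨ ∑-zero (fillings M J) ⟩
      0
        ≡⟨ ℕ.*-zeroʳ (𝟙 (ρ ≤? r)) ⟨
      𝟙 (ρ ≤? r) * 0
        ≡⟨ cong (λ z → 𝟙 (ρ ≤? r) * (z * _)) (𝟙-no (endsWith? J r c) (λ e → ¬v (proj₁ e))) ⟨
      𝟙 (ρ ≤? r) * (𝟙 (endsWith? J r c) * ∑ (fillings M (removeBox J r)) (λ T′ → 𝟙 (P′? r T′))) ∎
      where open ≡-Reasoning
    ∑-topmostIn-row r r<J (yes v) = begin
      ∑ (fillings M J) (λ T → 𝟙 (P? T) * 𝟙 (topmostIn? r T))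
        ≡⟨ ∑-fillings-removeBox J r pJ v _ ⟩
      ∑ (fillings M J′) (λ T′ → ∑ (allFin M) (λ x → 𝟙 (P? (addBox T′ r x)) * 𝟙 (topmostIn? r (addBox T′ r x))))
        ≡⟨ ∑-fillings-cong J′ (λ T′ s → trans (∑-cong (allFin M) (𝟙-addBox r v T′ s)) (∑-allFin-𝟙≡ M x₀ _)) ⟩
      ∑ (fillings M J′) (λ T′ → 𝟙 (ρ ≤? r) * (𝟙 (ends? r) * 𝟙 (P′? r T′)))
        ≡⟨ trans (∑-*ˡ (fillings M J′) (𝟙 (ρ ≤? r)) _) (cong (𝟙 (ρ ≤? r) *_) (∑-*ˡ (fillings M J′) (𝟙 (ends? r)) _)) ⟩
      𝟙 (ρ ≤? r) * (𝟙 (ends? r) * ∑ (fillings M J′) (λ T′ → 𝟙 (P′? r T′)))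
        ≡⟨ cong (λ z → 𝟙 (ρ ≤? r) * (z * _)) (𝟙-cong (ends? r) (endsWith? J r c) (v ,_) proj₂) ⟩
      𝟙 (ρ ≤? r) * (𝟙 (endsWith? J r c) * ∑ (fillings M J′) (λ T′ → 𝟙 (P′? r T′))) ∎
      where
      open ≡-Reasoning
      J′ = removeBox J r

    ∑-by-removedBox : ∑ (fillings M J) (λ T → 𝟙 (P? T)) ≡
                      ∑ (upTo (length J)) (λ r → 𝟙 (ρ ≤? r) * (𝟙 (endsWith? J r c) *
                                                   ∑ (fillings M (removeBox J r)) (λ T′ → 𝟙 (P′? r T′))))
    ∑-by-removedBox =
      trans (∑-by-topmostRow (fillings M J) (length J) P? (All-fillings J (λ T s p → marked T s p , Shape-length s)))
            (∑-congᴬ (upTo (length J)) (All-upTo (length J)) (λ r r<J → ∑-topmostIn-row r r<J (removable? J r)))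

-- The tableau side

-- once the last letter c of u_i is placed, in row r, the other boxes containing i lie weakly below row r
rowBound : ∀ {A : Set} → List A → ℕ → ℕ
rowBound []      r = 0
rowBound (_ ∷ _) r = r

module CITCount {k m : ℕ} where

  module Mark (i : Fin m) = TopmostRow {Fin m} {_≡ i} (_≟ᶠ i)

  IsCITOf : Sentence k → Mono k m → Fin m → ℕ → List (List (Fin m)) → Set
  IsCITOf J u i ρ T = IsCIT T × monoT J T ≡ u × Mark.AbsentAbove i ρ T

  isCITOf? : ∀ J u i ρ T → Dec (IsCITOf J u i ρ T)
  isCITOf? J u i ρ T = isCIT? T ×-dec mono-≟ (monoT J T) u ×-dec Mark.absentAbove? i ρ T

  #CIT : Sentence k → Mono k m → Fin m → ℕ → ℕ
  #CIT J u i ρ = ∑ (fillings m J) (λ T → 𝟙 (isCITOf? J u i ρ T))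

  coeffS≡#CIT : ∀ (J : Sentence k) (u : Mono k m) i → coeffS J u ≡ #CIT J u i 0
  coeffS≡#CIT J u i =
    trans (count≡∑𝟙 _ (fillings m J))
          (∑-cong (fillings m J) (λ T → 𝟙-cong (isCIT? T ×-dec mono-≟ (monoT J T) u) (isCITOf? J u i 0 T)
                                               (λ (a , b) → a , b , []) (λ (a , b , _) → a , b)))

  entries≤ : ∀ {J : Sentence k} {T : List (List (Fin m))} {v : Mono k m} (i : Fin m) → Shape J T → monoT J T ≡ v →
             (∀ j → i F.< j → lookup v j ≡ []) → All (F._≤ i) (concat T)
  entries≤ {J} {T} i s refl empty =
    All-tabulate≡ (concat T) (λ y y∈T → ℕ.≮⇒≥ (λ i<y → ∈⇒monoT≢[] y s y∈T (empty y i<y)))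

  module _ {u : Mono k m} (d : LastLetter u) where
    open LastLetter d

    lookup⁻->i : ∀ j → i F.< j → lookup u⁻ j ≡ []
    lookup⁻->i j i<j = trans (sym (lookup-≢i j (λ { refl → FinP.<-irrefl refl i<j }))) (lookup->i j i<j)

    i∈CIT : ∀ {J T} → Shape J T → monoT J T ≡ u → Any (_≡ i) (concat T)
    i∈CIT {J} {T} s refl with any? (_≟ᶠ i) (concat T)
    ... | yes a  = a
    ... | no i∉T = ⊥-elim (∷ʳ≢[] w (trans (sym lookup-i) (∉⇒monoT≡[] J T i i∉T)))

    removeLast-weight : ∀ (J′ : Sentence k) (T′ : List (List (Fin m))) r c₀ → Shape J′ T′ → r ≤ length J′ →
                        Mark.AbsentAbove i r T′ → monoT (addBox J′ r c₀) (addBox T′ r i) ≡ u →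
                        c₀ ≡ c × monoT J′ T′ ≡ u⁻
    removeLast-weight J′ T′ r c₀ s h i∉above mt = c₀≡c , lookup-ext _ _ (λ j → atIndex j (j ≟ᶠ i))
      where
      added : ∀ j → lookup (monoT J′ T′) j ++ rowColorsOf j (c₀ ∷ [] , i ∷ []) ≡ lookup u j
      added j = trans (sym (monoT-addBox J′ T′ r c₀ i s h i∉above j)) (cong (λ z → lookup z j) mt)
      atI : lookup (monoT J′ T′) i ∷ʳ c₀ ≡ w ∷ʳ c
      atI = trans (cong (lookup (monoT J′ T′) i ++_) (sym (rowColorsOf-single-≡ c₀ i))) (trans (added i) lookup-i)
      c₀≡c : c₀ ≡ c
      c₀≡c = ListP.∷ʳ-injectiveʳ (lookup (monoT J′ T′) i) w atI
      atIndex : ∀ j → Dec (j ≡ i) → lookup (monoT J′ T′) j ≡ lookup u⁻ j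
      atIndex j (yes refl) = trans (ListP.∷ʳ-injectiveˡ (lookup (monoT J′ T′) i) w atI) (sym lookup⁻-i)
      atIndex j (no j≢i)  = begin
        lookup (monoT J′ T′) j                                       ≡⟨ ListP.++-identityʳ _ ⟨
        lookup (monoT J′ T′) j ++ []                                 ≡⟨ cong (_ ++_) (rowColorsOf-single-≢ c₀ i j (λ e → j≢i (sym e))) ⟨
        lookup (monoT J′ T′) j ++ rowColorsOf j (c₀ ∷ [] , i ∷ [])   ≡⟨ added j ⟩
        lookup u j                                                   ≡⟨ lookup-≢i j j≢i ⟩
        lookup u⁻ j                                                  ∎
        where open ≡-Reasoning

    CIT-removeLast : ∀ (J′ : Sentence k) (T′ : List (List (Fin m))) r c₀ x ρ → IsSentence J′ → Shape J′ T′ →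
                     r ≤ length J′ → IsCITOf (addBox J′ r c₀) u i ρ (addBox T′ r x) →
                     Mark.TopmostIn i r (addBox T′ r x) →
                     x ≡ i × ρ ≤ r × c₀ ≡ c × IsCITOf J′ u⁻ i (rowBound w r) T′
    CIT-removeLast J′ T′ r c₀ x ρ pJ′ s h (cit , mt , i∉ρ) (i∈r , i∉r) =
      x≡i , ρ≤r , proj₁ weight , isCIT-addBox⁻ T′ r x (Shape-nonEmpty s pJ′) hT cit , proj₂ weight , i∉bound w
      where
      hT = Shape-lengthʳ s h
      entries≤i = entries≤ i (Shape-addBox r c₀ x s h) mt lookup->i
      x≡i : x ≡ i
      x≡i = FinP.≤-antisym (All-lookup≡ entries≤i (Any-rowAt⇒Any-concat (addBox T′ r x) r (∈-rowAt-addBox T′ r x hT)))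
                           (All-lookup≡ (row-maximum T′ r x hT (proj₁ cit)) (subst (Any (_≡ i)) (rowAt-addBox T′ r x hT) i∈r))
      ρ≤r : ρ ≤ r
      ρ≤r = ℕ.≮⇒≥ (λ r<ρ → Mark.absentAbove⇒∉row i ρ (addBox T′ r x) r i∉ρ r<ρ i∈r)
      i∉above : Mark.AbsentAbove i r T′
      i∉above = subst (All _) (take-addBox T′ r x hT) i∉r
      weight = removeLast-weight J′ T′ r c₀ s h i∉above (subst (λ z → monoT (addBox J′ r c₀) (addBox T′ r z) ≡ u) x≡i mt)
      i∉bound : ∀ w′ → Mark.AbsentAbove i (rowBound w′ r) T′
      i∉bound []      = []
      i∉bound (_ ∷ _) = i∉above

    CIT-addLast : ∀ (J′ : Sentence k) (T′ : List (List (Fin m))) r ρ → IsSentence J′ → Shape J′ T′ →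
                  r ≤ length J′ → ρ ≤ r → IsCITOf J′ u⁻ i (rowBound w r) T′ →
                  IsCITOf (addBox J′ r c) u i ρ (addBox T′ r i) × Mark.TopmostIn i r (addBox T′ r i)
    CIT-addLast J′ T′ r ρ pJ′ s h ρ≤r (cit′ , mt′ , i∉bound) =
      (cit , mt , Mark.absentAbove-mono i ρ r (addBox T′ r i) ρ≤r i∉r) , ∈-rowAt-addBox T′ r i hT , i∉r
      where
      hT = Shape-lengthʳ s h
      i∉above : Mark.AbsentAbove i r T′
      i∉above = fromBound w lookup⁻-i i∉bound
        where
        fromBound : ∀ w′ → lookup u⁻ i ≡ w′ → Mark.AbsentAbove i (rowBound w′ r) T′ → Mark.AbsentAbove i r T′
        fromBound (_ ∷ _) _ a = a
        fromBound []      e _ = Mark.∉⇒absentAbove i r T′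
          (λ i∈T′ → ∈⇒monoT≢[] i s i∈T′ (trans (cong (λ z → lookup z i) mt′) e))
      i∉r = subst (All _) (sym (take-addBox T′ r i hT)) i∉above
      entries≤i = entries≤ i s mt′ lookup⁻->i
      mt : monoT (addBox J′ r c) (addBox T′ r i) ≡ u
      mt = lookup-ext _ _ λ j → trans (monoT-addBox J′ T′ r c i s h i∉above j) (atIndex j (j ≟ᶠ i))
        where
        atIndex : ∀ j → Dec (j ≡ i) → lookup (monoT J′ T′) j ++ rowColorsOf j (c ∷ [] , i ∷ []) ≡ lookup u j
        atIndex j (yes refl) = trans (cong₂ _++_ (trans (cong (λ z → lookup z i) mt′) lookup⁻-i) (rowColorsOf-single-≡ c i))
                                     (sym lookup-i)
        atIndex j (no j≢i)  = trans (cong₂ _++_ (cong (λ z → lookup z j) mt′) (rowColorsOf-single-≢ c i j (λ e → j≢i (sym e))))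
                                    (trans (ListP.++-identityʳ _) (sym (lookup-≢i j j≢i)))
      cit : IsCIT (addBox T′ r i)
      cit = isCIT-addBox⁺ T′ r i (Shape-nonEmpty s pJ′) hT cit′ entries≤i
              (λ { refl → All.zipWith (λ (e≤i , e≢i) → FinP.≤∧≢⇒< e≤i e≢i)
                                      (entries≤i , Mark.absentAbove-all i T′ i∉above) })

    #CIT-rec : ∀ (J : Sentence k) → IsSentence J → ∀ ρ →
               #CIT J u i ρ ≡
               ∑ (upTo (length J)) (λ r → 𝟙 (ρ ≤? r) * (𝟙 (endsWith? J r c) * #CIT (removeBox J r) u⁻ i (rowBound w r)))
    #CIT-rec J pJ ρ =
      RemovedBox.∑-by-removedBox (_≟ᶠ i) J pJ (isCITOf? J u i ρ) ρ c i (λ r → isCITOf? (removeBox J r) u⁻ i (rowBound w r))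
        record
          { marked       = λ T s (_ , mt , _) → i∈CIT s mt
          ; notRemovable = λ r T s r<J ¬v (cit , mt , _) (i∈r , _) →
                             maximum-in-removable-row J T r i pJ s r<J ¬v cit i∈r (entries≤ i s mt lookup->i)
          ; remove       = remove
          ; add          = add
          }
      where
      remove : ∀ r T′ x → Removable J r → Shape (removeBox J r) T′ → IsCITOf J u i ρ (addBox T′ r x) →
               Mark.TopmostIn i r (addBox T′ r x) →
               x ≡ i × ρ ≤ r × last (rowAt J r) ≡ just c × IsCITOf (removeBox J r) u⁻ i (rowBound w r) T′
      remove r T′ x v s p t =
        let c₀ , lc , J≡ , pJ′ , h = removeBox-removable J r pJ v
            x≡i , ρ≤r , c₀≡c , p′ = CIT-removeLast (removeBox J r) T′ r c₀ x ρ pJ′ s h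
                                      (subst (λ Z → IsCITOf Z u i ρ (addBox T′ r x)) (sym J≡) p) t
        in x≡i , ρ≤r , subst (λ z → last (rowAt J r) ≡ just z) c₀≡c lc , p′
      add : ∀ r T′ → Removable J r → Shape (removeBox J r) T′ → ρ ≤ r → last (rowAt J r) ≡ just c →
            IsCITOf (removeBox J r) u⁻ i (rowBound w r) T′ →
            IsCITOf J u i ρ (addBox T′ r i) × Mark.TopmostIn i r (addBox T′ r i)
      add r T′ v s ρ≤r ends p′ =
        let c₀ , lc , J≡ , pJ′ , h = removeBox-removable J r pJ v
            p , t = CIT-addLast (removeBox J r) T′ r ρ pJ′ s h ρ≤r p′
            J≡′ = trans (cong (addBox (removeBox J r) r) (MaybeP.just-injective (trans (sym ends) lc))) J≡
        in subst (λ Z → IsCITOf Z u i ρ (addBox T′ r i)) J≡′ p , t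

All-upTo-lookup : ∀ {P : ℕ → Set} {n l} → All P (upTo n) → l < n → P l
All-upTo-lookup a lt = All.lookup a (∈P.∈-upTo⁺ lt)

All-upTo-∷ʳ⁻ : ∀ {P : ℕ → Set} n → All P (upTo (suc n)) → All P (upTo n) × P n
All-upTo-∷ʳ⁻ n a with a₁ , (p ∷ []) ← AllP.++⁻ (upTo n) (subst (All _) (sym (ListP.upTo-∷ʳ n)) a) = a₁ , p

All-upTo-∷ʳ⁺ : ∀ {P : ℕ → Set} n → All P (upTo n) → P n → All P (upTo (suc n))
All-upTo-∷ʳ⁺ n a p = subst (All _) (ListP.upTo-∷ʳ n) (AllP.++⁺ a (p ∷ []))

All-Any-witness : ∀ {A : Set} {P Q : A → Set} {xs : List A} → All P xs → Any Q xs → Σ A λ e → P e × Q e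
All-Any-witness (p ∷ _) (here q)  = _ , p , q
All-Any-witness (_ ∷ a) (there q) = All-Any-witness a q

module _ {A B : Set} where

  mapMaybe-congᴬ : ∀ {f g : A → Maybe B} (xs : List A) → All (λ y → f y ≡ g y) xs → mapMaybe f xs ≡ mapMaybe g xs
  mapMaybe-congᴬ                 []       _       = refl
  mapMaybe-congᴬ {f = f} {g} (x ∷ xs) (e ∷ a) with f x | g x | e
  ... | just v  | _ | refl = cong (v ∷_) (mapMaybe-congᴬ xs a)
  ... | nothing | _ | refl = mapMaybe-congᴬ xs a

  mapMaybe-nothing : ∀ {f : A → Maybe B} (xs : List A) → All (λ y → f y ≡ nothing) xs → mapMaybe f xs ≡ []
  mapMaybe-nothing             []       _       = refl
  mapMaybe-nothing {f = f} (x ∷ xs) (e ∷ a) with f x | e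
  ... | nothing | refl = mapMaybe-nothing xs a

  mapMaybe-∷-just : ∀ (f : A → Maybe B) x xs {v} → f x ≡ just v → mapMaybe f (x ∷ xs) ≡ v ∷ mapMaybe f xs
  mapMaybe-∷-just f x xs e rewrite e = refl

  mapMaybe-∷-nothing : ∀ (f : A → Maybe B) x xs → f x ≡ nothing → mapMaybe f (x ∷ xs) ≡ mapMaybe f xs
  mapMaybe-∷-nothing f x xs e rewrite e = refl

module _ {N : ℕ} where

  Any-toℕ⇒∈ : ∀ {xs : List (Fin N)} {a} → Any (λ e → toℕ e ≡ a) xs → Σ (Fin N) λ y → toℕ y ≡ a × Any (_≡ y) xs
  Any-toℕ⇒∈ (here q)  = _ , q , here refl
  Any-toℕ⇒∈ (there a) = let y , q , b = Any-toℕ⇒∈ a in y , q , there b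

  ∈⇒Any-toℕ : ∀ {t : List (Fin N)} {y a} → toℕ y ≡ a → Any (_≡ y) t → Any (λ e → toℕ e ≡ a) t
  ∈⇒Any-toℕ q (here refl) = here q
  ∈⇒Any-toℕ q (there b)   = there (∈⇒Any-toℕ q b)

  ∉⇒¬Any-toℕ : ∀ {t : List (Fin N)} {y a} → toℕ y ≡ a → ¬ Any (_≡ y) t → ¬ Any (λ e → toℕ e ≡ a) t
  ∉⇒¬Any-toℕ q y∉t a = let e , q′ , e∈t = Any-toℕ⇒∈ a in
    y∉t (subst (λ z → Any (_≡ z) _) (FinP.toℕ-injective (trans q′ (sym q))) e∈t)

  All<suc⇒All< : ∀ {n} (xs : List (Fin N)) → All (λ e → toℕ e < suc n) xs → ¬ Any (λ e → toℕ e ≡ n) xs →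
                 All (λ e → toℕ e < n) xs
  All<suc⇒All< xs a na =
    All-tabulate≡ xs (λ y b → ℕ.≤∧≢⇒< (ℕ.≤-pred (All-lookup≡ a b)) (λ q → na (∈⇒Any-toℕ q b)))

allFin-split : ∀ {N} (x : Fin N) → Σ (List (Fin N)) λ A → Σ (List (Fin N)) λ Bs →
               allFin N ≡ A ++ x ∷ Bs × All (_≢ x) A × All (λ y → toℕ x < toℕ y) Bs
allFin-split {suc N} fzero    = [] , map fsuc (allFin N) , allFin-suc N , [] , AllP.map⁺ (All.universal (λ _ → s≤s z≤n) (allFin N))
allFin-split {suc N} (fsuc x) =
  let A , Bs , e , a , b = allFin-split x in
  fzero ∷ map fsuc A , map fsuc Bs ,
  trans (allFin-suc N) (cong (fzero ∷_) (trans (cong (map fsuc) e) (ListP.map-++ fsuc A (x ∷ Bs)))) ,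
  (λ ()) ∷ AllP.map⁺ (All.map (λ x′≢x q → x′≢x (FinP.suc-injective q)) a) ,
  AllP.map⁺ (All.map s≤s b)

module _ {k N : ℕ} where

  Box : Set
  Box = ℕ × Fin k × Fin N

  entry : Box → Fin N
  entry b = proj₂ (proj₂ b)

  entries : List Box → List (Fin N)
  entries = map entry

  locate-∉ : ∀ (B : List Box) y → ¬ Any (_≡ y) (entries B) → locate B y ≡ nothing
  locate-∉ []                y _  = refl
  locate-∉ ((r , c , e) ∷ B) y na with e ≟ᶠ y
  ... | yes q = ⊥-elim (na (here q))
  ... | no _  = locate-∉ B y (λ a → na (there a))

  locate-∈ : ∀ (B : List Box) y → Any (_≡ y) (entries B) → Σ (ℕ × Fin k) λ v → locate B y ≡ just v
  locate-∈ ((r , c , e) ∷ B) y a with e ≟ᶠ y | a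
  ... | yes _   | _        = (r , c) , refl
  ... | no e≢y | here q   = ⊥-elim (e≢y q)
  ... | no _    | there a′ = locate-∈ B y a′

  locate-++-∉ : ∀ (A B : List Box) y → ¬ Any (_≡ y) (entries A) → locate (A ++ B) y ≡ locate B y
  locate-++-∉ []                B y _  = refl
  locate-++-∉ ((r , c , e) ∷ A) B y na with e ≟ᶠ y
  ... | yes q = ⊥-elim (na (here q))
  ... | no _  = locate-++-∉ A B y (λ a → na (there a))

  locate-++-∈ : ∀ (A B : List Box) y → Any (_≡ y) (entries A) → locate (A ++ B) y ≡ locate A y
  locate-++-∈ ((r , c , e) ∷ A) B y a with e ≟ᶠ y | a
  ... | yes _   | _        = refl
  ... | no e≢y | here q   = ⊥-elim (e≢y q)
  ... | no _    | there a′ = locate-++-∈ A B y a′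

  locate-skip : ∀ (pre : List Box) b post y → entry b ≢ y → locate (pre ++ b ∷ post) y ≡ locate (pre ++ post) y
  locate-skip []                  (r , c , e) post y e≢y with e ≟ᶠ y
  ... | yes q = ⊥-elim (e≢y q)
  ... | no _  = refl
  locate-skip ((r , c , e) ∷ pre) b           post y e≢y with e ≟ᶠ y
  ... | yes _ = refl
  ... | no _  = locate-skip pre b post y e≢y

  locate-hit : ∀ (pre : List Box) r c x post → ¬ Any (_≡ x) (entries pre) →
               locate (pre ++ (r , c , x) ∷ post) x ≡ just (r , c)
  locate-hit pre r c x post x∉pre = trans (locate-++-∉ pre _ x x∉pre) found
    where
    found : locate ((r , c , x) ∷ post) x ≡ just (r , c)
    found with x ≟ᶠ x
    ... | yes _  = refl
    ... | no x≢x = ⊥-elim (x≢x refl)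

  boxesOfRow : ℕ → Word k → List (Fin N) → List Box
  boxesOfRow s w t = map (s ,_) (zip w t)

  entries-boxesOfRow : ∀ s (w : Word k) (t : List (Fin N)) → length t ≡ length w → entries (boxesOfRow s w t) ≡ t
  entries-boxesOfRow s []      []      _ = refl
  entries-boxesOfRow s (c ∷ w) (e ∷ t) h = cong (e ∷_) (entries-boxesOfRow s w t (ℕ.suc-injective h))

  entries-boxesRow : ∀ s {J : Sentence k} {U : List (List (Fin N))} → Shape J U → entries (boxesRow s J U) ≡ concat U
  entries-boxesRow s []                         = refl
  entries-boxesRow s {w ∷ J} {t ∷ U} (h ∷ sh) =
    trans (ListP.map-++ entry (boxesOfRow s w t) _) (cong₂ _++_ (entries-boxesOfRow s w t h) (entries-boxesRow (suc s) sh))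

  boxesRow-addBox : ∀ s (J : Sentence k) (U : List (List (Fin N))) r c x → Shape J U → r ≤ length J →
                    Σ (List Box) λ pre → Σ (List Box) λ post →
                    boxesRow s (addBox J r c) (addBox U r x) ≡ pre ++ (s + r , c , x) ∷ post × pre ++ post ≡ boxesRow s J U
  boxesRow-addBox s []      []      zero    c x []       _        =
    [] , [] , cong (λ z → (z , c , x) ∷ []) (sym (ℕ.+-identityʳ s)) , refl
  boxesRow-addBox s (w ∷ J) (t ∷ U) zero    c x (h ∷ sh) _        = boxesOfRow s w t , boxesRow (suc s) J U , added , refl
    where
    open ≡-Reasoning
    added = begin
      map (s ,_) (zip (w ∷ʳ c) (t ∷ʳ x)) ++ boxesRow (suc s) J U
        ≡⟨ cong (λ z → map (s ,_) z ++ boxesRow (suc s) J U) (zip-∷ʳ w t c x h) ⟩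
      map (s ,_) (zip w t ∷ʳ (c , x)) ++ boxesRow (suc s) J U
        ≡⟨ cong (_++ boxesRow (suc s) J U) (ListP.map-++ (s ,_) (zip w t) ((c , x) ∷ [])) ⟩
      (boxesOfRow s w t ++ (s , c , x) ∷ []) ++ boxesRow (suc s) J U
        ≡⟨ ListP.++-assoc (boxesOfRow s w t) _ _ ⟩
      boxesOfRow s w t ++ (s , c , x) ∷ boxesRow (suc s) J U
        ≡⟨ cong (λ z → boxesOfRow s w t ++ (z , c , x) ∷ boxesRow (suc s) J U) (sym (ℕ.+-identityʳ s)) ⟩
      boxesOfRow s w t ++ (s + 0 , c , x) ∷ boxesRow (suc s) J U ∎
  boxesRow-addBox s (w ∷ J) (t ∷ U) (suc r) c x (h ∷ sh) (s≤s hr) =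
    let pre , post , added , rest = boxesRow-addBox (suc s) J U r c x sh hr in
    boxesOfRow s w t ++ pre , post ,
    trans (cong (boxesOfRow s w t ++_) added)
          (trans (sym (ListP.++-assoc (boxesOfRow s w t) pre _))
                 (cong (λ z → (boxesOfRow s w t ++ pre) ++ (z , c , x) ∷ post) (sym (ℕ.+-suc s r)))) ,
    trans (ListP.++-assoc (boxesOfRow s w t) pre post) (cong (boxesOfRow s w t ++_) rest)

  locate-boxesOfRow : ∀ s (w : Word k) (t : List (Fin N)) y q c → locate (boxesOfRow s w t) y ≡ just (q , c) → q ≡ s
  locate-boxesOfRow s (_ ∷ w) (e ∷ t) y q c found with e ≟ᶠ y
  ... | yes _ = cong proj₁ (sym (MaybeP.just-injective found))
  ... | no _  = locate-boxesOfRow s w t y q c found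

  locate-row : ∀ s {J : Sentence k} {U : List (List (Fin N))} y q c → Shape J U → locate (boxesRow s J U) y ≡ just (q , c) →
               Σ ℕ λ r → q ≡ s + r × Any (_≡ y) (rowAt U r) × All (λ t → ¬ Any (_≡ y) t) (take r U)
  locate-row s {w ∷ J} {t ∷ U} y q c (h ∷ sh) found with any? (_≟ᶠ y) t
  ... | yes y∈t = 0 , trans (locate-boxesOfRow s w t y q c inRow) (sym (ℕ.+-identityʳ s)) , y∈t , []
    where
    inRow = trans (sym (locate-++-∈ (boxesOfRow s w t) _ y (subst (Any _) (sym (entries-boxesOfRow s w t h)) y∈t))) found
  ... | no y∉t
    with r , q≡ , y∈r , above ← locate-row (suc s) y q c sh
           (trans (sym (locate-++-∉ (boxesOfRow s w t) _ y (subst (λ z → ¬ Any _ z) (sym (entries-boxesOfRow s w t h)) y∉t))) found)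
    = suc r , trans q≡ (sym (ℕ.+-suc s r)) , y∈r , y∉t ∷ above

module _ {k : ℕ} where

  -- whether a new last entry placed in row r begins a new word of co_A
  descentAt : List (ℕ × Fin k) → ℕ → Bool
  descentAt []             r = true
  descentAt ((q , _) ∷ []) r = q <ᵇ r
  descentAt (_ ∷ p ∷ ps)   r = descentAt (p ∷ ps) r

  descentFlags-∷ʳ : ∀ (L : List (ℕ × Fin k)) r c₀ → descentFlags (L ∷ʳ (r , c₀)) ≡ descentFlags L ∷ʳ (c₀ , descentAt L r)
  descentFlags-∷ʳ []            r c₀ = refl
  descentFlags-∷ʳ ((q , c) ∷ L) r c₀ = cong ((c , true) ∷_) (after q c L)
    where
    after : ∀ q c L → descentFlagsAfter q (L ∷ʳ (r , c₀)) ≡ descentFlagsAfter q L ∷ʳ (c₀ , descentAt ((q , c) ∷ L) r)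
    after q c []              = refl
    after q c ((q′ , c′) ∷ L) = cong ((c′ , (q <ᵇ q′)) ∷_) (after q′ c′ L)

  descentAt-∷ʳ : ∀ (L : List (ℕ × Fin k)) q col r → descentAt (L ∷ʳ (q , col)) r ≡ (q <ᵇ r)
  descentAt-∷ʳ []           q col r = refl
  descentAt-∷ʳ (p ∷ [])     q col r = refl
  descentAt-∷ʳ (p ∷ p′ ∷ L) q col r = descentAt-∷ʳ (p′ ∷ L) q col r

-- The standard side, with entries in Fin N of which only 0,…,n-1 are used

module StdCount {k m N : ℕ} where

  module Mark (a : ℕ) = TopmostRow {Fin N} {λ e → toℕ e ≡ a} (λ e → toℕ e ℕ.≟ a)

  reading : Sentence k → List (List (Fin N)) → List (ℕ × Fin k)
  reading J U = mapMaybe (locate (boxesRow 0 J U)) (allFin N)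

  EachOnce : ℕ → List (List (Fin N)) → Set
  EachOnce n U = All (λ l → count (λ e → toℕ e ℕ.≟ l) (concat U) ≡ 1) (upTo n)

  Standard : ℕ → List (List (Fin N)) → Set
  Standard n U = IsCIT U × EachOnce n U × All (λ e → toℕ e < n) (concat U)

  standard? : ∀ n U → Dec (Standard n U)
  standard? n U = isCIT? U ×-dec all? (λ l → count (λ e → toℕ e ℕ.≟ l) (concat U) ℕ.≟ 1) (upTo n)
                  ×-dec all? (λ e → toℕ e ℕ.<? n) (concat U)

  Compatible : Mono k m → Sentence k → List (List (Fin N)) → Set
  Compatible u J U = Refines (monoFlags u) (descentFlags (reading J U))

  IsStdOf : Sentence k → Mono k m → ℕ → List (List (Fin N)) → Set
  IsStdOf J u ρ U = Standard (size J) U × Compatible u J U × Mark.AbsentAbove (pred (size J)) ρ U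

  isStdOf? : ∀ J u ρ U → Dec (IsStdOf J u ρ U)
  isStdOf? J u ρ U = standard? (size J) U ×-dec refines? (monoFlags u) (descentFlags (reading J U))
                     ×-dec Mark.absentAbove? (pred (size J)) ρ U

  #Std : Sentence k → Mono k m → ℕ → ℕ
  #Std J u ρ = ∑ (fillings N J) (λ U → 𝟙 (isStdOf? J u ρ U))

  reading-addBox : ∀ (J : Sentence k) (U : List (List (Fin N))) r c x → Shape J U → r ≤ length J →
                   ¬ Any (_≡ x) (concat U) → All (λ e → toℕ e < toℕ x) (concat U) →
                   reading (addBox J r c) (addBox U r x) ≡ reading J U ∷ʳ (r , c)
  reading-addBox J U r c x s h x∉U <x
    with pre , post , added , rest ← boxesRow-addBox 0 J U r c x s h
    with A , Bs , split , A≢x , x<Bs ← allFin-split x = begin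
    reading (addBox J r c) (addBox U r x)
      ≡⟨ cong (λ B → mapMaybe (locate B) (allFin N)) added ⟩
    mapMaybe new (allFin N)
      ≡⟨ cong (mapMaybe new) split ⟩
    mapMaybe new (A ++ x ∷ Bs)
      ≡⟨ ListP.mapMaybe-++ new A (x ∷ Bs) ⟩
    mapMaybe new A ++ mapMaybe new (x ∷ Bs)
      ≡⟨ cong₂ _++_ sameBefore newAtX ⟩
    mapMaybe old A ++ (r , c) ∷ []
      ≡⟨ cong (_∷ʳ (r , c)) (ListP.++-identityʳ _) ⟨
    (mapMaybe old A ++ []) ∷ʳ (r , c)
      ≡⟨ cong (λ z → (mapMaybe old A ++ z) ∷ʳ (r , c)) (trans (mapMaybe-∷-nothing old x Bs (absent x (λ x∈ → x∉U (inU x∈)))) oldAfterX) ⟨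
    (mapMaybe old A ++ mapMaybe old (x ∷ Bs)) ∷ʳ (r , c)
      ≡⟨ cong (_∷ʳ (r , c)) (ListP.mapMaybe-++ old A (x ∷ Bs)) ⟨
    mapMaybe old (A ++ x ∷ Bs) ∷ʳ (r , c)
      ≡⟨ cong (λ z → mapMaybe old z ∷ʳ (r , c)) split ⟨
    mapMaybe old (allFin N) ∷ʳ (r , c)
      ≡⟨ cong (λ B → mapMaybe (locate B) (allFin N) ∷ʳ (r , c)) rest ⟩
    reading J U ∷ʳ (r , c) ∎
    where
    open ≡-Reasoning
    new = locate (pre ++ (r , c , x) ∷ post)
    old = locate (pre ++ post)
    inU : ∀ {y} → Any (_≡ y) (entries (pre ++ post)) → Any (_≡ y) (concat U)
    inU = subst (Any _) (trans (cong entries rest) (entries-boxesRow 0 s))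
    absent : ∀ y → ¬ Any (_≡ y) (entries (pre ++ post)) → old y ≡ nothing
    absent y = locate-∉ (pre ++ post) y
    afterX : ∀ {y} → toℕ x < toℕ y → ¬ Any (_≡ y) (entries (pre ++ post))
    afterX x<y y∈ = ℕ.<-asym x<y (All-lookup≡ <x (inU y∈))
    oldAfterX : mapMaybe old Bs ≡ []
    oldAfterX = mapMaybe-nothing Bs (All.map (λ {y} x<y → absent y (afterX x<y)) x<Bs)
    sameBefore : mapMaybe new A ≡ mapMaybe old A
    sameBefore = mapMaybe-congᴬ A (All.map (λ y≢x → locate-skip pre _ post _ (λ e → y≢x (sym e))) A≢x)
    newAtX : mapMaybe new (x ∷ Bs) ≡ (r , c) ∷ []
    newAtX = trans (mapMaybe-∷-just new x Bs
                     (locate-hit pre r c x post (λ x∈pre → x∉U (inU (subst (Any _) (sym (ListP.map-++ entry pre post)) (AnyP.++⁺ˡ x∈pre))))))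
                   (cong ((r , c) ∷_) (mapMaybe-nothing Bs (All.map (λ {y} x<y →
                      trans (locate-skip pre _ post y (λ e → ℕ.<-irrefl (cong toℕ e) x<y)) (absent y (afterX x<y))) x<Bs)))

  reading-last : ∀ (J : Sentence k) (U : List (List (Fin N))) y → Shape J U → Any (_≡ y) (concat U) →
                 All (λ e → toℕ e ≤ toℕ y) (concat U) →
                 Σ (List (ℕ × Fin k)) λ L → Σ (ℕ × Fin k) λ v → reading J U ≡ L ∷ʳ v × locate (boxesRow 0 J U) y ≡ just v
  reading-last J U y s y∈U ≤y
    with A , Bs , split , _ , y<Bs ← allFin-split y
    with v , found ← locate-∈ (boxesRow 0 J U) y (subst (Any _) (sym (entries-boxesRow 0 s)) y∈U) =
    mapMaybe (locate (boxesRow 0 J U)) A , v ,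
    trans (cong (mapMaybe (locate (boxesRow 0 J U))) split)
          (trans (ListP.mapMaybe-++ _ A (y ∷ Bs))
                 (cong (mapMaybe (locate (boxesRow 0 J U)) A ++_) (trans (mapMaybe-∷-just _ y Bs found) (cong (v ∷_) afterY)))) ,
    found
    where
    afterY : mapMaybe (locate (boxesRow 0 J U)) Bs ≡ []
    afterY = mapMaybe-nothing Bs (All.map (λ {y′} y<y′ → locate-∉ (boxesRow 0 J U) y′
               (λ y′∈ → ℕ.<-irrefl refl (ℕ.<-≤-trans y<y′ (All-lookup≡ ≤y (subst (Any _) (entries-boxesRow 0 s) y′∈))))) y<Bs)

  reading-empty : ∀ (J : Sentence k) (U : List (List (Fin N))) → Shape J U → All (λ e → toℕ e < 0) (concat U) → reading J U ≡ []
  reading-empty J U s <0 = mapMaybe-nothing (allFin N) (All.universal (λ y → locate-∉ (boxesRow 0 J U) y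
    (λ y∈ → ℕ.n≮0 (All-lookup≡ <0 (subst (Any _) (entries-boxesRow 0 s) y∈)))) (allFin N))

  count-addBox : ∀ (U : List (List (Fin N))) r x l → r ≤ length U →
                 count (λ e → toℕ e ℕ.≟ l) (concat (addBox U r x)) ≡
                 count (λ e → toℕ e ℕ.≟ l) (concat U) + 𝟙 (toℕ x ℕ.≟ l)
  count-addBox U r x l h = count-concat-addBox (λ e → toℕ e ℕ.≟ l) U r x h

  standard-removeLast : ∀ (U : List (List (Fin N))) r x n → All NonEmpty U → r ≤ length U →
                        Standard (suc n) (addBox U r x) → Any (λ e → toℕ e ≡ n) (rowAt (addBox U r x) r) →
                        toℕ x ≡ n × Standard n U × ¬ Any (λ e → toℕ e ≡ n) (concat U)
  standard-removeLast U r x n ne h (cit , once , <suc-n) n∈r = x≡n , (isCIT-addBox⁻ U r x ne h cit , once′ , <n) , n∉U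
    where
    entries≤x = All-concat-addBox⁻ U r x h <suc-n
    x≡n : toℕ x ≡ n
    x≡n = ℕ.≤-antisym (ℕ.≤-pred (proj₂ entries≤x))
            (let e , e≤x , e≡n = All-Any-witness (row-maximum U r x h (proj₁ cit)) (subst (Any _) (rowAt-addBox U r x h) n∈r)
             in subst (_≤ toℕ x) e≡n e≤x)
    onceBelow = proj₁ (All-upTo-∷ʳ⁻ n once)
    onceAtN = proj₂ (All-upTo-∷ʳ⁻ n once)
    n∉U : ¬ Any (λ e → toℕ e ≡ n) (concat U)
    n∉U = count≡0⇒¬Any _ (concat U)
            (ℕ.+-cancelʳ-≡ 1 _ 0 (trans (cong (_ +_) (sym (𝟙-yes (toℕ x ℕ.≟ n) x≡n))) (trans (sym (count-addBox U r x n h)) onceAtN)))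
    once′ : EachOnce n U
    once′ = All.zipWith (λ (l<n , onceAtL) →
              trans (sym (ℕ.+-identityʳ _))
                    (trans (cong (_ +_) (sym (𝟙-no (toℕ x ℕ.≟ _) (λ x≡l → ℕ.<-irrefl (trans (sym x≡l) x≡n) l<n))))
                           (trans (sym (count-addBox U r x _ h)) onceAtL)))
              (All-upTo n , onceBelow)
    <n = All<suc⇒All< (concat U) (proj₁ entries≤x) n∉U

  standard-addLast : ∀ (U : List (List (Fin N))) r x n → All NonEmpty U → r ≤ length U → toℕ x ≡ n →
                     Standard n U → Standard (suc n) (addBox U r x) × ¬ Any (λ e → toℕ e ≡ n) (concat U)
  standard-addLast U r x n ne h x≡n (cit , once , <n) = (cit′ , once′ , <suc-n) , n∉U
    where
    n∉U : ¬ Any (λ e → toℕ e ≡ n) (concat U)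
    n∉U n∈U = let e , e<n , e≡n = All-Any-witness <n n∈U in ℕ.<-irrefl e≡n e<n
    <x : All (F._< x) (concat U)
    <x = All.map (subst (_ <_) (sym x≡n)) <n
    cit′ = isCIT-addBox⁺ U r x ne h cit (All.map ℕ.<⇒≤ <x) (λ _ → <x)
    once′ : EachOnce (suc n) (addBox U r x)
    once′ = All-upTo-∷ʳ⁺ n
      (All.zipWith (λ (l<n , onceAtL) →
         trans (count-addBox U r x _ h)
               (trans (cong (_ +_) (𝟙-no (toℕ x ℕ.≟ _) (λ x≡l → ℕ.<-irrefl (trans (sym x≡l) x≡n) l<n)))
                      (trans (ℕ.+-identityʳ _) onceAtL)))
         (All-upTo n , once))
      (trans (count-addBox U r x n h) (cong₂ _+_ (count≡0 _ (concat U) n∉U) (𝟙-yes (toℕ x ℕ.≟ n) x≡n)))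
    <suc-n = All-concat-addBox⁺ U r x h (All.map ℕ.m<n⇒m<1+n <n) (subst (_< suc n) (sym x≡n) (ℕ.n<1+n n))

  descentAt⇔absentAbove : ∀ (J : Sentence k) (U : List (List (Fin N))) a r → Shape J U → Standard (suc a) U →
                          (descentAt (reading J U) r ≢ true → Mark.AbsentAbove a r U) ×
                          (Mark.AbsentAbove a r U → descentAt (reading J U) r ≢ true)
  descentAt⇔absentAbove J U a r s (cit , once , <suc-a)
    with y , y≡a , y∈U ← Any-toℕ⇒∈ (count≡1⇒Any _ (concat U) (All-upTo-lookup once (ℕ.n<1+n a)))
    with L , (q , col) , reading≡ , found ← reading-last J U y s y∈U (All.map (λ lt → subst (_ ≤_) (sym y≡a) (ℕ.≤-pred lt)) <suc-a)
    with q′ , refl , y∈q , above ← locate-row 0 y q col s found =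
    (λ ¬desc → Mark.absentAbove-mono a r q U (ℕ.≮⇒≥ (λ r<q → ¬desc (trans descent≡ (T⇒≡true (ℕ.<⇒<ᵇ r<q)))))
                                     (All.map (∉⇒¬Any-toℕ y≡a) above)) ,
    (λ a∉above desc → Mark.absentAbove⇒∉row a r U q a∉above (ℕ.<ᵇ⇒< q r (≡true⇒T (trans (sym descent≡) desc))) (∈⇒Any-toℕ y≡a y∈q))
    where
    descent≡ : descentAt (reading J U) r ≡ (q <ᵇ r)
    descent≡ = trans (cong (λ z → descentAt z r) reading≡) (descentAt-∷ʳ L q col r)
    T⇒≡true : ∀ {b} → T b → b ≡ true
    T⇒≡true {true} _ = refl
    ≡true⇒T : ∀ {b} → b ≡ true → T b
    ≡true⇒T refl = _

  module _ {u : Mono k m} (d : LastLetter u) where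
    open LastLetter d

    -- the last flag of co_A(U) belongs to the entry in the added box
    compatible-addBox : ∀ (J : Sentence k) (U : List (List (Fin N))) r c₀ x → Shape J U → r ≤ length J →
                        ¬ Any (_≡ x) (concat U) → All (λ e → toℕ e < toℕ x) (concat U) →
                        Compatible u (addBox J r c₀) (addBox U r x) ⇔
                        (Compatible u⁻ J U × (c , null w) ≼ (c₀ , descentAt (reading J U) r))
    compatible-addBox J U r c₀ x s h x∉U <x = mk⇔
      (λ cp → refines-∷ʳ⁻ (monoFlags u⁻) (descentFlags (reading J U)) (subst₂ Refines monoFlags≡ flags≡ cp))
      (λ (cp , last≼) → subst₂ Refines (sym monoFlags≡) (sym flags≡) (Pointwise.++⁺ cp (last≼ ∷ [])))
      where
      flags≡ : descentFlags (reading (addBox J r c₀) (addBox U r x)) ≡ descentFlags (reading J U) ∷ʳ (c₀ , descentAt (reading J U) r)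
      flags≡ = trans (cong descentFlags (reading-addBox J U r c₀ x s h x∉U <x)) (descentFlags-∷ʳ (reading J U) r c₀)

    noDescent⇒absentAbove : ∀ (J : Sentence k) (U : List (List (Fin N))) r → Shape J U → ∀ n → Standard n U →
                            descentAt (reading J U) r ≢ true → Mark.AbsentAbove (pred n) r U
    noDescent⇒absentAbove J U r s zero    (_ , _ , <0) _  =
      Mark.∉⇒absentAbove 0 r U (λ 0∈ → ℕ.n≮0 (proj₁ (proj₂ (All-Any-witness <0 0∈))))
    noDescent⇒absentAbove J U r s (suc a) std          ¬d = proj₁ (descentAt⇔absentAbove J U a r s std) ¬d

    -- with n = 0 the reading is empty, so u⁻ would be 1, contradicting w ≢ []
    absentAbove⇒noDescent : ∀ (J : Sentence k) (U : List (List (Fin N))) r → Shape J U → w ≢ [] → ∀ n → Standard n U →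
                            Compatible u⁻ J U → Mark.AbsentAbove (pred n) r U → descentAt (reading J U) r ≢ true
    absentAbove⇒noDescent J U r s w≢[] zero    (_ , _ , <0) cp _ _ =
      w≢[] (trans (sym lookup⁻-i)
                  (trans (cong (λ z → lookup z i)
                               (monoFlags≡[] u⁻ (refines-[]⁻ (subst (Refines (monoFlags u⁻)) (cong descentFlags (reading-empty J U s <0)) cp))))
                         (lookup-oneM i)))
    absentAbove⇒noDescent J U r s w≢[] (suc a) std          cp above = proj₂ (descentAt⇔absentAbove J U a r s std) above

    std-removeLast : ∀ (J : Sentence k) (U : List (List (Fin N))) r c₀ x ρ → IsSentence J → Shape J U → r ≤ length J →
                     Standard (suc (size J)) (addBox U r x) → Compatible u (addBox J r c₀) (addBox U r x) →
                     Mark.AbsentAbove (size J) ρ (addBox U r x) → Mark.TopmostIn (size J) r (addBox U r x) →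
                     toℕ x ≡ size J × ρ ≤ r × c₀ ≡ c × IsStdOf J u⁻ (rowBound w r) U
    std-removeLast J U r c₀ x ρ pJ s h std cp ρ-above (n∈r , _) =
      x≡n , ρ≤r , sym (proj₁ last≼) , std′ , cp′ , bound w (proj₂ last≼)
      where
      n = size J
      removed = standard-removeLast U r x n (Shape-nonEmpty s pJ) (Shape-lengthʳ s h) std n∈r
      x≡n = proj₁ removed
      std′ = proj₁ (proj₂ removed)
      n∉U = proj₂ (proj₂ removed)
      ρ≤r : ρ ≤ r
      ρ≤r = ℕ.≮⇒≥ (λ r<ρ → Mark.absentAbove⇒∉row n ρ (addBox U r x) r ρ-above r<ρ n∈r)
      split = Equivalence.to (compatible-addBox J U r c₀ x s h (λ x∈ → n∉U (∈⇒Any-toℕ x≡n x∈))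
                                                    (All.map (subst (_ <_) (sym x≡n)) (proj₂ (proj₂ std′)))) cp
      cp′ = proj₁ split
      last≼ = proj₂ split
      bound : ∀ (w′ : Word k) → (descentAt (reading J U) r ≡ true → null w′ ≡ true) →
              Mark.AbsentAbove (pred n) (rowBound w′ r) U
      bound []      _     = []
      bound (_ ∷ _) desc⇒ = noDescent⇒absentAbove J U r s n std′ (λ desc → case desc⇒ desc of λ ())

    std-addLast : ∀ (J : Sentence k) (U : List (List (Fin N))) r x ρ → IsSentence J → Shape J U → r ≤ length J →
                  toℕ x ≡ size J → ρ ≤ r → IsStdOf J u⁻ (rowBound w r) U →
                  (Standard (suc (size J)) (addBox U r x) × Compatible u (addBox J r c) (addBox U r x) ×
                   Mark.AbsentAbove (size J) ρ (addBox U r x)) × Mark.TopmostIn (size J) r (addBox U r x)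
    std-addLast J U r x ρ pJ s h x≡n ρ≤r (std′ , cp′ , bound) =
      (std , cp , Mark.absentAbove-mono n ρ r (addBox U r x) ρ≤r n∉above) , n∈r , n∉above
      where
      n = size J
      hU = Shape-lengthʳ s h
      added = standard-addLast U r x n (Shape-nonEmpty s pJ) hU x≡n std′
      std = proj₁ added
      n∉U = proj₂ added
      desc⇒ : ∀ (w′ : Word k) → w ≡ w′ → Mark.AbsentAbove (pred n) (rowBound w′ r) U →
              descentAt (reading J U) r ≡ true → null w′ ≡ true
      desc⇒ []      _  _     _    = refl
      desc⇒ (_ ∷ _) w≡ above desc =
        ⊥-elim (absentAbove⇒noDescent J U r s (λ w≡[] → case trans (sym w≡) w≡[] of λ ()) n std′ cp′ above desc)
      cp = Equivalence.from (compatible-addBox J U r c x s h (λ x∈ → n∉U (∈⇒Any-toℕ x≡n x∈))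
                                               (All.map (subst (_ <_) (sym x≡n)) (proj₂ (proj₂ std′))))
             (cp′ , refl , desc⇒ w refl bound)
      n∈r : Any (λ e → toℕ e ≡ n) (rowAt (addBox U r x) r)
      n∈r = subst (Any _) (sym (rowAt-addBox U r x hU)) (AnyP.++⁺ʳ (rowAt U r) (here x≡n))
      n∉above : Mark.AbsentAbove n r (addBox U r x)
      n∉above = subst (All _) (sym (take-addBox U r x hU)) (Mark.∉⇒absentAbove n r U n∉U)

    #Std-rec : ∀ (J : Sentence k) → IsSentence J → ∀ n → size J ≡ suc n → n < N → ∀ ρ →
               #Std J u ρ ≡
               ∑ (upTo (length J)) (λ r → 𝟙 (ρ ≤? r) * (𝟙 (endsWith? J r c) * #Std (removeBox J r) u⁻ (rowBound w r)))
    #Std-rec J pJ n size≡ n<N ρ =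
      RemovedBox.∑-by-removedBox (λ e → toℕ e ℕ.≟ pred (size J)) J pJ (isStdOf? J u ρ) ρ c (fromℕ< n<N)
        (λ r → isStdOf? (removeBox J r) u⁻ (rowBound w r))
        record
          { marked       = λ U s ((_ , once , _) , _) →
                             count≡1⇒Any _ (concat U) (All-upTo-lookup once (subst (λ z → pred z < z) (sym size≡) (ℕ.n<1+n n)))
          ; notRemovable = λ r U s r<J ¬v ((cit , _ , entries<) , _) (n∈r , _) →
                             let y , y≡ , y∈r = Any-toℕ⇒∈ n∈r in
                             maximum-in-removable-row J U r y pJ s r<J ¬v cit y∈r
                               (All.map (λ e< → subst (_ ≤_) (sym y≡) (ℕ.pred-mono-≤ e<)) entries<)
          ; remove       = remove
          ; add          = add
          }
      where
      -- the conditions with the size of J abstracted, to transport them along size J ≡ suc (size J′)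
      Added : ℕ → Sentence k → ℕ → List (List (Fin N)) → Set
      Added s Z r U = (Standard s U × Compatible u Z U × Mark.AbsentAbove (pred s) ρ U) × Mark.TopmostIn (pred s) r U
      size-removeBox : ∀ r → Removable J r → size J ≡ suc (size (removeBox J r))
      size-removeBox r v =
        let c₀ , _ , J≡ , _ , h = removeBox-removable J r pJ v
        in trans (cong size (sym J≡)) (size-addBox (removeBox J r) r c₀ h)
      toℕ-x₀ : ∀ r → Removable J r → toℕ (fromℕ< n<N) ≡ size (removeBox J r)
      toℕ-x₀ r v = trans (FinP.toℕ-fromℕ< n<N) (ℕ.suc-injective (trans (sym size≡) (size-removeBox r v)))
      remove : ∀ r U′ x → Removable J r → Shape (removeBox J r) U′ → IsStdOf J u ρ (addBox U′ r x) →
               Mark.TopmostIn (pred (size J)) r (addBox U′ r x) →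
               x ≡ fromℕ< n<N × ρ ≤ r × last (rowAt J r) ≡ just c × IsStdOf (removeBox J r) u⁻ (rowBound w r) U′
      remove r U′ x v s p t =
        let c₀ , lc , J≡ , pJ′ , h = removeBox-removable J r pJ v
            (std , cp , above) , top = subst₂ (λ s Z → Added s Z r (addBox U′ r x)) (size-removeBox r v) (sym J≡) (p , t)
            x≡ , ρ≤r , c₀≡c , p′ = std-removeLast (removeBox J r) U′ r c₀ x ρ pJ′ s h std cp above top
        in FinP.toℕ-injective (trans x≡ (sym (toℕ-x₀ r v))) , ρ≤r , subst (λ z → last (rowAt J r) ≡ just z) c₀≡c lc , p′
      add : ∀ r U′ → Removable J r → Shape (removeBox J r) U′ → ρ ≤ r → last (rowAt J r) ≡ just c →
            IsStdOf (removeBox J r) u⁻ (rowBound w r) U′ →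
            IsStdOf J u ρ (addBox U′ r (fromℕ< n<N)) × Mark.TopmostIn (pred (size J)) r (addBox U′ r (fromℕ< n<N))
      add r U′ v s ρ≤r ends p′ =
        let c₀ , lc , J≡ , pJ′ , h = removeBox-removable J r pJ v
            J≡′ = trans (cong (addBox (removeBox J r) r) (MaybeP.just-injective (trans (sym ends) lc))) J≡
            q = std-addLast (removeBox J r) U′ r (fromℕ< n<N) ρ pJ′ s h (toℕ-x₀ r v) ρ≤r p′
        in subst₂ (λ s Z → Added s Z r (addBox U′ r (fromℕ< n<N))) (sym (size-removeBox r v)) J≡′ q

mapMaybe≡[]⁻ : ∀ {A B : Set} (f : A → Maybe B) (xs : List A) → mapMaybe f xs ≡ [] → All (λ x → f x ≡ nothing) xs
mapMaybe≡[]⁻ f []       _ = []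
mapMaybe≡[]⁻ f (x ∷ xs) e with f x in eq
... | nothing = eq ∷ mapMaybe≡[]⁻ f xs e

descentFlags≡[]⁻ : ∀ {k} (xs : List (ℕ × Fin k)) → descentFlags xs ≡ [] → xs ≡ []
descentFlags≡[]⁻ []      _ = refl
descentFlags≡[]⁻ (_ ∷ _) ()

shape-nonEmpty-entry : ∀ {k M} {J : Sentence k} {T : List (List (Fin M))} → IsSentence J → J ≢ [] → Shape J T →
                       Σ (Fin M) λ e → Any (_≡ e) (concat T)
shape-nonEmpty-entry {T = []}          _       J≢[] [] = ⊥-elim (J≢[] refl)
shape-nonEmpty-entry {T = [] ∷ T}      pJ      _    s  with () ← All.head (Shape-nonEmpty s pJ) refl
shape-nonEmpty-entry {T = (e ∷ t) ∷ T} _       _    _  = e , here refl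

module _ {k m : ℕ} where
  open CITCount {k} {m}

  monoT-[] : monoT {k} {m} [] [] ≡ oneM
  monoT-[] = tabulate-[]

  monoT≢oneM : ∀ {J : Sentence k} {T : List (List (Fin m))} → IsSentence J → J ≢ [] → Shape J T → monoT J T ≢ oneM
  monoT≢oneM pJ J≢[] s mt = let e , e∈T = shape-nonEmpty-entry pJ J≢[] s in
    ∈⇒monoT≢[] e s e∈T (trans (cong (λ z → lookup z e) mt) (lookup-oneM e))

  #CIT-[] : ∀ (u : Mono k m) i ρ → #CIT [] u i ρ ≡ 𝟙 (mono-≟ u oneM)
  #CIT-[] u i ρ = trans (ℕ.+-identityʳ _)
    (𝟙-cong (isCITOf? [] u i ρ []) (mono-≟ u oneM) (λ (_ , mt , _) → trans (sym mt) monoT-[])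
            (λ u≡1 → ([] , []) , trans monoT-[] (sym u≡1) , AllP.take⁺ ρ []))

  #CIT-oneM : ∀ (J : Sentence k) → IsSentence J → J ≢ [] → ∀ i ρ → #CIT J oneM i ρ ≡ 0
  #CIT-oneM J pJ J≢[] i ρ =
    trans (∑-fillings-cong J (λ T s → 𝟙-no (isCITOf? J oneM i ρ T) (λ (_ , mt , _) → monoT≢oneM pJ J≢[] s mt)))
          (∑-zero (fillings m J))

  coeffS-oneM : ∀ (J : Sentence k) → IsSentence J → coeffS J (oneM {k} {m}) ≡ 𝟙 (sent-≟ J [])
  coeffS-oneM []      _  =
    trans (count≡∑𝟙 (λ T → isCIT? T ×-dec mono-≟ (monoT [] T) oneM) ([] ∷ []))
          (trans (ℕ.+-identityʳ _) (𝟙-yes (isCIT? [] ×-dec mono-≟ (monoT [] []) oneM) (([] , []) , monoT-[])))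
  coeffS-oneM (w ∷ J) pJ =
    trans (count≡0 _ (fillings m (w ∷ J)) λ a →
             let T , T∈ , _ , mt = All-Any-witness (All-fillings (w ∷ J) (λ T s → s)) a in monoT≢oneM pJ (λ ()) T∈ mt)
          refl

module _ {k m N : ℕ} where
  open StdCount {k} {m} {N}

  reading-[] : reading [] [] ≡ []
  reading-[] = mapMaybe-nothing (allFin N) (All.universal (λ _ → refl) (allFin N))

  reading≢[] : ∀ {J : Sentence k} {U : List (List (Fin N))} y → Shape J U → Any (_≡ y) (concat U) → reading J U ≢ []
  reading≢[] {J} {U} y s y∈U e with locate-∈ (boxesRow 0 J U) y (subst (Any (_≡ y)) (sym (entries-boxesRow 0 s)) y∈U)
  ... | v , found with () ← trans (sym found) (All.lookup (mapMaybe≡[]⁻ _ (allFin N) e) (∈P.∈-allFin y))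

  #Std-[] : ∀ (u : Mono k m) ρ → #Std [] u ρ ≡ 𝟙 (mono-≟ u oneM)
  #Std-[] u ρ = trans (ℕ.+-identityʳ _)
    (𝟙-cong (isStdOf? [] u ρ []) (mono-≟ u oneM)
            (λ (_ , cp , _) → monoFlags≡[] u (refines-[]⁻ (subst (λ z → Refines (monoFlags u) (descentFlags z)) reading-[] cp)))
            (λ { refl → ((([] , []) , [] , []) ,
                           subst₂ Refines (sym (monoFlags-oneM {k} {m})) (cong descentFlags (sym reading-[])) [] ,
                           AllP.take⁺ ρ []) }))

  #Std-oneM : ∀ (J : Sentence k) → IsSentence J → ∀ ρ → #Std J oneM ρ ≡ 𝟙 (sent-≟ J [])
  #Std-oneM []      _  ρ = trans (#Std-[] oneM ρ) (𝟙-yes (mono-≟ oneM oneM) refl)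
  #Std-oneM (w ∷ J) pJ ρ =
    trans (∑-fillings-cong (w ∷ J) (λ U s → 𝟙-no (isStdOf? (w ∷ J) oneM ρ U) (λ (_ , cp , _) → incompatible s cp)))
          (∑-zero (fillings N (w ∷ J)))
    where
    incompatible : ∀ {U} → Shape (w ∷ J) U → ¬ Compatible oneM (w ∷ J) U
    incompatible {U} s cp =
      let e , e∈U = shape-nonEmpty-entry pJ (λ ()) s in
      reading≢[] e s e∈U (descentFlags≡[]⁻ (reading (w ∷ J) U)
        (refines-[]ˡ⁻ (subst (λ z → Refines z (descentFlags (reading (w ∷ J) U))) (monoFlags-oneM {k} {m}) cp)))

length-mapMaybe : ∀ {A B : Set} (f : A → Maybe B) (xs : List A) → All (λ y → f y ≢ nothing) xs →
                  length (mapMaybe f xs) ≡ length xs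
length-mapMaybe f []       _       = refl
length-mapMaybe f (x ∷ xs) (h ∷ a) with f x | h
... | just _  | _   = cong suc (length-mapMaybe f xs a)
... | nothing | h≢ = ⊥-elim (h≢ refl)

module _ {k m : ℕ} (J : Sentence k) (u : Mono k m) where
  open StdCount {k} {m} {size J}

  -- IsStandard counts the entries as elements of Fin n, Standard counts them by their values in ℕ
  isStandard⇒standard : ∀ U → IsStandard U → Standard (size J) U
  isStandard⇒standard U (cit , once) =
    cit ,
    AllP.applyUpTo⁺₁ (λ l → l) (size J) (λ {l} l<n →
      trans (count-cong (λ e → toℕ e ℕ.≟ l) (_≟ᶠ fromℕ< l<n) (concat U)
                        (λ e q → FinP.toℕ-injective (trans q (sym (FinP.toℕ-fromℕ< l<n))))
                        (λ e q → trans (cong toℕ q) (FinP.toℕ-fromℕ< l<n)))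
            (All.lookup once (∈P.∈-allFin (fromℕ< l<n)))) ,
    All.universal FinP.toℕ<n (concat U)

  standard⇒isStandard : ∀ U → Standard (size J) U → IsStandard U
  standard⇒isStandard U (cit , once , _) =
    cit ,
    All.universal (λ i → trans (count-cong (_≟ᶠ i) (λ e → toℕ e ℕ.≟ toℕ i) (concat U) (λ e → cong toℕ) (λ e → FinP.toℕ-injective))
                               (All-upTo-lookup once (FinP.toℕ<n i)))
                  (allFin (size J))

  coA-isSentence : ∀ U → IsSentence (coA J U)
  coA-isSentence U = proj₂ (coFrom-flags (reading J U))

  size-coA : ∀ U → Shape J U → IsStandard U → size (coA J U) ≡ size J
  size-coA U s (_ , once) = begin
    size (coFrom (reading J U))  ≡⟨ size-coFrom (reading J U) ⟩
    length (reading J U)         ≡⟨ length-mapMaybe _ (allFin (size J)) (All.universal located (allFin (size J))) ⟩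
    length (allFin (size J))     ≡⟨ ListP.length-tabulate (λ i → i) ⟩
    size J                       ∎
    where
    open ≡-Reasoning
    located : ∀ y → locate (boxesRow 0 J U) y ≢ nothing
    located y e
      with v , found ← locate-∈ (boxesRow 0 J U) y
             (subst (Any (_≡ y)) (sym (entries-boxesRow 0 s)) (count≡1⇒Any (_≟ᶠ y) (concat U) (All.lookup once (∈P.∈-allFin y))))
      with () ← trans (sym found) e

  -- for a standard U, the sum over C keeps only C = co_A(U), and F_{co_A(U)} contains u iff U is compatible with u
  ∑-L*coeffF≡#Std : sum (map (λ C → L J C * coeffF C u) (sentencesOfSize k (size J))) ≡ #Std J u 0
  ∑-L*coeffF≡#Std = begin
    ∑ Cs (λ C → L J C * coeffF C u)
      ≡⟨ ∑-cong Cs (λ C → trans (cong (_* coeffF C u) (trans (count≡∑𝟙 _ Us) (∑-cong Us (λ U → 𝟙-× (isStandard? U) (sent-≟ (coA J U) C)))))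
                                (sym (∑-*ʳ Us (coeffF C u) _))) ⟩
    ∑ Cs (λ C → ∑ Us (λ U → 𝟙 (isStandard? U) * 𝟙 (sent-≟ (coA J U) C) * coeffF C u))
      ≡⟨ ∑-swap Cs Us _ ⟩
    ∑ Us (λ U → ∑ Cs (λ C → 𝟙 (isStandard? U) * 𝟙 (sent-≟ (coA J U) C) * coeffF C u))
      ≡⟨ ∑-fillings-cong J (λ U s → onlyCoA U s (isStandard? U)) ⟩
    #Std J u 0 ∎
    where
    open ≡-Reasoning
    Cs = sentencesOfSize k (size J)
    Us = fillings (size J) J
    onlyCoA : ∀ U → Shape J U → (std? : Dec (IsStandard U)) →
              ∑ Cs (λ C → 𝟙 std? * 𝟙 (sent-≟ (coA J U) C) * coeffF C u) ≡ 𝟙 (isStdOf? J u 0 U)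
    onlyCoA U s (no ¬std) = trans (∑-zero Cs) (sym (𝟙-no (isStdOf? J u 0 U) (λ p → ¬std (standard⇒isStandard U (proj₁ p)))))
    onlyCoA U s (yes std) = begin
      ∑ Cs (λ C → 1 * 𝟙 (sent-≟ (coA J U) C) * coeffF C u)
        ≡⟨ ∑-cong Cs (λ C → trans (cong (_* coeffF C u) (ℕ.*-identityˡ (𝟙 (sent-≟ (coA J U) C))))
                                  (cong (_* coeffF C u) (𝟙-cong (sent-≟ (coA J U) C) (sent-≟ C (coA J U)) sym sym))) ⟩
      ∑ Cs (λ C → 𝟙 (sent-≟ C (coA J U)) * coeffF C u)
        ≡⟨ ∑-𝟙≡ sent-≟ Cs (coA J U) (λ C → coeffF C u) ⟩
      count (λ C → sent-≟ C (coA J U)) Cs * coeffF (coA J U) u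
        ≡⟨ cong (_* coeffF (coA J U) u)
                (trans (count≡∑𝟙 _ Cs) (∑-sentencesOfSize-𝟙≡ (size J) (coA J U) (coA-isSentence U) (size-coA U s std))) ⟩
      1 * coeffF (coA J U) u
        ≡⟨ ℕ.*-identityˡ _ ⟩
      coeffF (coA J U) u
        ≡⟨ coeffF≡𝟙-refines (coA J U) (coA-isSentence U) u ⟩
      𝟙 (refines? (flags (nonemptyWords u)) (flags (coA J U)))
        ≡⟨ 𝟙-cong (refines? (flags (nonemptyWords u)) (flags (coA J U))) (isStdOf? J u 0 U)
                  (λ r → isStandard⇒standard U std , subst₂ Refines (sym (monoFlags≡flags u)) (proj₁ (coFrom-flags (reading J U))) r , [])
                  (λ (_ , cp , _) → subst₂ Refines (monoFlags≡flags u) (sym (proj₁ (coFrom-flags (reading J U)))) cp) ⟩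
      𝟙 (isStdOf? J u 0 U) ∎

-- The induction on the number of boxes

lastNonempty-unique : ∀ {A : Set} {m} (v : Vec (List A) m) i i′ → lookup v i ≢ [] → lookup v i′ ≢ [] →
                      (∀ j → i F.< j → lookup v j ≡ []) → (∀ j → i′ F.< j → lookup v j ≡ []) → i ≡ i′
lastNonempty-unique v i i′ v[i]≢[] v[i′]≢[] after-i after-i′ with FinP.<-cmp i i′
... | tri< i<i′ _ _ = ⊥-elim (v[i′]≢[] (after-i i′ i<i′))
... | tri≈ _ i≡i′ _ = i≡i′
... | tri> _ _ i′<i = ⊥-elim (v[i]≢[] (after-i′ i i′<i))

size-removeBox : ∀ {k} (J : Sentence k) r → IsSentence J → Removable J r → size J ≡ suc (size (removeBox J r))
size-removeBox J r pJ v =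
  let c₀ , _ , J≡ , _ , h = removeBox-removable J r pJ v
  in trans (cong size (sym J≡)) (size-addBox (removeBox J r) r c₀ h)

size-∷ : ∀ {k} (w : Word k) J → w ≢ [] → Σ ℕ λ n → size (w ∷ J) ≡ suc n
size-∷ []      J h = ⊥-elim (h refl)
size-∷ (c ∷ w) J h = _ , refl

module _ {k m : ℕ} where
  open CITCount {k} {m}

  LastLetter-unique : ∀ {u : Mono k m} (d d′ : LastLetter u) → LastLetter.i d ≡ LastLetter.i d′
  LastLetter-unique {u} d d′ = lastNonempty-unique u (LastLetter.i d) (LastLetter.i d′)
    (λ e → ∷ʳ≢[] (LastLetter.w d) (trans (sym (LastLetter.lookup-i d)) e))
    (λ e → ∷ʳ≢[] (LastLetter.w d′) (trans (sym (LastLetter.lookup-i d′)) e))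
    (LastLetter.lookup->i d) (LastLetter.lookup->i d′)

  -- the bound ρ constrains the entry i only when i is the index of the last letter of u
  data Anchored (u : Mono k m) (i : Fin m) : ℕ → Set where
    unbounded    : Anchored u i 0
    atLastLetter : ∀ {ρ} (d : LastLetter u) → LastLetter.i d ≡ i → Anchored u i ρ

  #CIT-reanchor : ∀ J {u} i ρ (d : LastLetter u) → Anchored u i ρ → #CIT J u i ρ ≡ #CIT J u (LastLetter.i d) ρ
  #CIT-reanchor J {u} i ρ d unbounded = trans (sym (coeffS≡#CIT J u i)) (coeffS≡#CIT J u (LastLetter.i d))
  #CIT-reanchor J i ρ d (atLastLetter d′ refl) = cong (λ z → #CIT J _ z ρ) (LastLetter-unique d′ d)

  anchored-rowBound : ∀ {u : Mono k m} (d : LastLetter u) r →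
                      Anchored (LastLetter.u⁻ d) (LastLetter.i d) (rowBound (LastLetter.w d) r)
  anchored-rowBound d r = fromWord (LastLetter.w d) (LastLetter.lookup⁻-i d)
    where
    open LastLetter d
    fromWord : ∀ w′ → lookup u⁻ i ≡ w′ → Anchored u⁻ i (rowBound w′ r)
    fromWord []      _ = unbounded
    fromWord (y ∷ ys) e with lastLetter u⁻
    ... | inj₁ refl with () ← trans (sym e) (lookup-oneM i)
    ... | inj₂ d′   = atLastLetter d′ (lastNonempty-unique u⁻ (LastLetter.i d′) i
        (λ e′ → ∷ʳ≢[] (LastLetter.w d′) (trans (sym (LastLetter.lookup-i d′)) e′)) (λ e′ → case (trans (sym e) e′))
        (LastLetter.lookup->i d′) (lookup⁻->i d))
      where
      case : y ∷ ys ≢ []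
      case ()

module _ {k m N : ℕ} where
  open CITCount {k} {m}
  open StdCount {k} {m} {N}

  #CIT≡#Std : ∀ n (J : Sentence k) → IsSentence J → size J ≡ n → n ≤ N →
              ∀ u i ρ → Anchored u i ρ → #CIT J u i ρ ≡ #Std J u ρ
  #CIT≡#Std n []            _  _     _   u i ρ _ = trans (#CIT-[] u i ρ) (sym (#Std-[] u ρ))
  #CIT≡#Std n J@(w₀ ∷ J₀) pJ size≡ n≤N u i ρ a with lastLetter u
  ... | inj₁ refl = trans (#CIT-oneM J pJ (λ ()) i ρ) (sym (#Std-oneM {m = m} {N = N} J pJ ρ))
  ... | inj₂ d with size-∷ w₀ J₀ (All.head pJ)
  ...   | n′ , size≡′ with refl ← trans (sym size≡′) size≡ = begin
    #CIT J u i ρ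
      ≡⟨ #CIT-reanchor J i ρ d a ⟩
    #CIT J u i′ ρ
      ≡⟨ #CIT-rec d J pJ ρ ⟩
    ∑ (upTo (length J)) (λ r → 𝟙 (ρ ≤? r) * (𝟙 (endsWith? J r c) * #CIT (removeBox J r) u⁻ i′ (rowBound w r)))
      ≡⟨ ∑-cong (upTo (length J)) (λ r → cong (𝟙 (ρ ≤? r) *_) (byRow r (endsWith? J r c))) ⟩
    ∑ (upTo (length J)) (λ r → 𝟙 (ρ ≤? r) * (𝟙 (endsWith? J r c) * #Std (removeBox J r) u⁻ (rowBound w r)))
      ≡⟨ #Std-rec d J pJ n′ size≡′ n≤N ρ ⟨
    #Std J u ρ ∎
    where
    open ≡-Reasoning
    open LastLetter d renaming (i to i′)
    byRow : ∀ r (ends? : Dec (EndsWith J r c)) →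
            𝟙 ends? * #CIT (removeBox J r) u⁻ i′ (rowBound w r) ≡ 𝟙 ends? * #Std (removeBox J r) u⁻ (rowBound w r)
    byRow r (no _)        = refl
    byRow r (yes (v , _)) =
      let _ , _ , _ , pJ′ , _ = removeBox-removable J r pJ v in
      cong (1 *_) (#CIT≡#Std n′ (removeBox J r) pJ′ (ℕ.suc-injective (trans (sym (size-removeBox J r pJ v)) size≡′))
                             (ℕ.<⇒≤ n≤N) u⁻ i′ (rowBound w r) (anchored-rowBound d r))

coeffS≡#Std : ∀ {k m} (J : Sentence k) → IsSentence J → (u : Mono k m) → coeffS J u ≡ StdCount.#Std {k} {m} {size J} J u 0
coeffS≡#Std {m = m} J pJ u with lastLetter u
... | inj₂ d    = trans (CITCount.coeffS≡#CIT J u (LastLetter.i d))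
                        (#CIT≡#Std (size J) J pJ refl ℕ.≤-refl u (LastLetter.i d) 0 unbounded)
... | inj₁ refl = trans (coeffS-oneM J pJ) (sym (#Std-oneM {m = m} {N = size J} J pJ 0))

theorem4p25 : (k : ℕ) (J : Sentence k) → IsSentence J →
              (m : ℕ) (u : Mono k m) →
              coeffS J u ≡ sum (map (λ C → L J C * coeffF C u) (sentencesOfSize k (size J)))
theorem4p25 k J pJ m u = trans (coeffS≡#Std J pJ u) (sym (∑-L*coeffF≡#Std J u))
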